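{- For scalars $a_\lambda$, $\lambda\in\mathcal{P}$, $$B^{\perp}(t^{ -1})\, \sum_{\lambda\in\mathcal{P}}a_{\lambda}s_{\lambda}=\sum_{\alpha\in\mathcal{P}}s_{\alpha} \sum_{m\ge 1}(-1)^{|\alpha |-|\alpha^{(m)}|+m-1}\, t^{|\alpha |-|\alpha^{(m)}|}\,a_{\alpha^{(m)}}.$$
   Context: $\mathcal{P}$ is the set of all partitions (including the empty one), $|\lambda|$ the size. Symmetric functions are over $\mathbb{Q}$ in countably many variables; $p_k,h_k,e_k,s_\lambda$ are the power sum, complete, elementary and Schur symmetric functions, and sums $\sum a_\lambda s_\lambda$ are formal. With the bilinear form $\langle s_\lambda,s_\mu\rangle=\delta_{\lambda,\mu}$, $f^\perp$ denotes the adjoint of multiplication by $f$. Define $B^{\perp}(t)=\sum_{k,m\ge0}(-1)^m t^{k-m} e_m\,h_k^{\perp}$ (equivalently $B^\perp(t)=\exp\big(-\sum_{k\ge1}\tfrac{t^{ -k}}{k}p_k\big)\exp\big(\sum_{k\ge1}t^{k}\tfrac{\partial}{\partial p_k}\big)$), so $B^\perp(t^{ -1})$ is obtained by replacing $t$ by $t^{ -1}$. The code of a partition $\lambda$ is the two-way infinite word in U, R (infinitely U to the left, infinitely R to the right) recording the lower-right boundary lattice path of its diagram (English convention, corner at origin), coming up the $y$-axis and leaving along the $x$-axis. For $m\ge1$, $\alpha^{(m)}$ is the partition whose code is obtained from that of $\alpha$ by changing the $m$th R from the left into U; explicitly, if $\alpha=(\alpha_1,\dots,\alpha_n)$ then $\alpha^{(m)}=(\alpha_1-1,\dots,\alpha_j-1,m-1,\alpha_{j+1},\dots,\alpha_n)$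 where $\alpha_j\ge m>\alpha_{j+1}$ (with $\alpha_0=\infty$, $\alpha_{n+1}=0$). -}

module Defs where

open import Data.Bool using (Bool; true; false; if_then_else_; _∧_)
open import Data.Nat as ℕ using (ℕ; zero; suc; _∸_; _⊔_; _⊓_; _≤ᵇ_; _≡ᵇ_)
open import Data.Nat.Properties using ()
open import Data.Integer as ℤ using (ℤ; +_; ∣_∣)
open import Data.Rational as ℚ using (ℚ; 0ℚ; 1ℚ; -_)
open import Data.List using (List; []; _∷_; map; concatMap; foldr; upTo; length)
open import Data.Nat.ListAction using (sum)
open import Data.Product using (Σ; ∃; _×_; _,_)
open import Relation.Binary.PropositionalEquality using (_≡_)

data IsPartition : List ℕ → Set where
  nil  : IsPartition []
  one  : ∀ {x} → 1 ℕ.≤ x → IsPartition (x ∷ [])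
  cons : ∀ {x y ys} → y ℕ.≤ x → IsPartition (y ∷ ys) → IsPartition (x ∷ y ∷ ys)

size : List ℕ → ℕ
size = sum

-- i-th part (0-indexed), padded with zeros
part : List ℕ → ℕ → ℕ
part []       _       = 0
part (x ∷ _)  zero    = x
part (_ ∷ xs) (suc i) = part xs i

-- all partitions of n with parts ≤ b (fuel f ≥ n guarantees completeness)
partsF : ℕ → ℕ → ℕ → List (List ℕ)
partsF _       zero    _ = [] ∷ []
partsF zero    (suc _) _ = []
partsF (suc f) (suc n) b =
  concatMap (λ i → map (suc i ∷_) (partsF f (n ∸ i) (suc i))) (upTo (b ⊓ suc n))

partitionsOf : ℕ → List (List ℕ)
partitionsOf n = partsF n n n

allBelow : ℕ → (ℕ → Bool) → Bool
allBelow zero    _ = true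
allBelow (suc n) p = allBelow n p ∧ p n

vstrip : List ℕ → List ℕ → Bool
vstrip μ ν = allBelow (suc (length μ ⊔ length ν))
  (λ i → (part μ i ≤ᵇ part ν i) ∧ (part ν i ≤ᵇ suc (part μ i)))

hstrip : List ℕ → List ℕ → Bool
hstrip μ λ' = allBelow (suc (length μ ⊔ length λ'))
  (λ i → (part λ' (suc i) ≤ᵇ part μ i) ∧ (part μ i ≤ᵇ part λ' i))

-- Symmetric functions (possibly infinite formal sums) are represented by
-- their coefficient functions in the Schur basis: g represents
-- Σ_{λ partition} g λ · s_λ  (values of g on non-partitions are ignored).

SymFun : Set
SymFun = List ℕ → ℚ

ℚsum : List ℚ → ℚ
ℚsum = foldr ℚ._+_ 0ℚ

-- multiplication by e_m (Pieri rule):  e_m s_μ = Σ_{ν/μ vertical m-strip} s_ν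
eMul : ℕ → SymFun → SymFun
eMul m g ν = if m ≤ᵇ size ν
  then ℚsum (map (λ μ → if vstrip μ ν then g μ else 0ℚ) (partitionsOf (size ν ∸ m)))
  else 0ℚ

-- h_k^⊥ (adjoint of multiplication by h_k, via Pieri):
--   h_k^⊥ s_λ = Σ_{λ/μ horizontal k-strip} s_μ
hPerp : ℕ → SymFun → SymFun
hPerp k g μ = ℚsum (map (λ λ' → if hstrip μ λ' then g λ' else 0ℚ) (partitionsOf (size μ ℕ.+ k)))

sgn : ℕ → ℚ
sgn zero          = 1ℚ
sgn (suc zero)    = - 1ℚ
sgn (suc (suc n)) = sgn n

sgnℤ : ℤ → ℚ
sgnℤ z = sgn ∣ z ∣

-- α^{(m)} = (α_1-1,…,α_j-1, m-1, α_{j+1},…,α_n) with α_j ≥ m > α_{j+1}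
-- (zero parts removed).

consPos : ℕ → List ℕ → List ℕ
consPos zero    ys = ys
consPos (suc y) ys = suc y ∷ ys

shift : ℕ → List ℕ → List ℕ
shift m []       = consPos (m ∸ 1) []
shift m (x ∷ xs) = if m ≤ᵇ x then consPos (x ∸ 1) (shift m xs)
                   else consPos (m ∸ 1) (x ∷ xs)

partialSum : (ℕ → ℚ) → ℕ → ℚ
partialSum f zero    = 0ℚ
partialSum f (suc n) = partialSum f n ℚ.+ f n

HasSum : (ℕ → ℚ) → ℚ → Set
HasSum f s = ∃ λ N → ∀ M → N ℕ.≤ M → partialSum f M ≡ s

-- Coefficient of t^d s_α in  B^⊥(t^{-1}) Σ_λ a_λ s_λ
--   = Σ_{k,m ≥ 0} (-1)^m t^{m-k} e_m h_k^⊥ (Σ a_λ s_λ),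
-- as a sum over m (with k = m - d forced, when ≥ 0).
lhsTerm : SymFun → List ℕ → ℤ → ℕ → ℚ
lhsTerm a α d m = if d ℤ.≤ᵇ + m
  then sgn m ℚ.* eMul m (hPerp ∣ + m ℤ.- d ∣ a) α
  else 0ℚ

-- Coefficient of t^d in the m-th summand (m = n+1 ≥ 1) of the right side
--   (-1)^{|α|-|α^{(m)}|+m-1} t^{|α|-|α^{(m)}|} a_{α^{(m)}} .
rhsTerm : SymFun → List ℕ → ℤ → ℕ → ℚ
rhsTerm a α d n =
  let m = suc n
      β = shift m α
      e = + size α ℤ.- + size β
  in if (e ℤ.≤ᵇ d) ∧ (d ℤ.≤ᵇ e)
     then sgnℤ (e ℤ.+ + m ℤ.- + 1) ℚ.* a β
     else 0ℚ

-- Write d = |α| - D. On the left, the coefficient of t^d s_α is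
--   Σ_m (-1)^m Σ_μ Σ_{|λ| = D} a_λ [α/μ vertical m-strip] [λ/μ horizontal strip]
--     = Σ_{|λ| = D} a_λ c(α, λ),   c(α, λ) = Σ_μ (-1)^{|α|-|μ|} [α/μ vertical strip] [λ/μ horizontal strip].
-- Both strip conditions relate μᵢ only to αᵢ, λᵢ and λᵢ₊₁, so c(α, λ) is the product over rows i of
--   Σ_x (-1)^{αᵢ-x} [x ∈ {αᵢ - 1, αᵢ}] [λᵢ₊₁ ≤ x ≤ λᵢ],
-- whose factors are 0 or ±1. Reading the product from the top row down, it is non-zero exactly when
-- λ = α⁽ᵐ⁾ for some m (the rows above the inserted part m - 1 each lose a box), and then it equals
-- (-1)^j, j being the number of shortened rows. Since |α⁽ᵐ⁾| is strictly increasing in m, at most one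
-- m has |α⁽ᵐ⁾| = D, and that single term is the coefficient on the right.

module Submission where

open import Defs
open import Data.Nat using (ℕ)
open import Data.Integer using (ℤ)
open import Data.Rational using (ℚ)
open import Data.List using (List)
open import Data.Product using (Σ; _×_)

open import Algebra.Bundles using (CommutativeMonoid)
import Algebra.Properties.CommutativeSemigroup as CommSemigroupProperties
open import Data.Bool using (Bool; true; false; if_then_else_; _∧_; T)
import Data.Bool.Properties as Boolₚ
open import Data.Nat as ℕ using (zero; suc; _∸_; _⊓_; _⊔_; _≤_; _<_; _≤ᵇ_; _≡ᵇ_; z≤n; s≤s)
import Data.Nat.Properties as ℕₚ
open import Data.Nat.Tactic.RingSolver using (solve-∀)
import Data.Integer.Tactic.RingSolver as ℤ-Solver
open import Data.Integer as ℤ using ()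
import Data.Integer.Properties as ℤₚ
open import Data.Rational using (0ℚ; 1ℚ; _+_; _*_; -_)
import Data.Rational.Properties as ℚₚ
open import Data.List using ([]; _∷_; map; concatMap; concat; upTo; applyUpTo; _++_; length)
open import Data.Sum using (_⊎_; inj₁; inj₂)
open import Function using (_∘_; id)
open import Relation.Nullary using (¬_; yes; no)
open import Data.Empty using (⊥-elim)
open import Data.Product using (_,_)
open import Data.List.Relation.Unary.All as All using (All; []; _∷_)
import Data.List.Properties as Listₚ
open import Relation.Binary.PropositionalEquality
open import Relation.Binary.Definitions using (tri<; tri≈; tri>)

open CommSemigroupProperties (CommutativeMonoid.commutativeSemigroup ℚₚ.+-0-commutativeMonoid)
  using (interchange)
open import Algebra.Properties.Ring ℚₚ.+-*-ring using (-1*x≈-x)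

private variable X Y : Set

sumMap : (X → ℚ) → List X → ℚ
sumMap f xs = ℚsum (map f xs)

sumMap-++ : (f : X → ℚ) (xs ys : List X) → sumMap f (xs ++ ys) ≡ sumMap f xs + sumMap f ys
sumMap-++ f []       ys = sym (ℚₚ.+-identityˡ _)
sumMap-++ f (x ∷ xs) ys = trans (cong (f x +_) (sumMap-++ f xs ys)) (sym (ℚₚ.+-assoc (f x) _ _))

sumMap-cong : {f g : X → ℚ} (xs : List X) → (∀ x → f x ≡ g x) → sumMap f xs ≡ sumMap g xs
sumMap-cong []       f≗g = refl
sumMap-cong (x ∷ xs) f≗g = cong₂ _+_ (f≗g x) (sumMap-cong xs f≗g)

sumMap-zero : (xs : List X) → sumMap (λ _ → 0ℚ) xs ≡ 0ℚ
sumMap-zero []       = refl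
sumMap-zero (x ∷ xs) = trans (ℚₚ.+-identityˡ _) (sumMap-zero xs)

sumMap-+ : (f g : X → ℚ) (xs : List X) → sumMap (λ x → f x + g x) xs ≡ sumMap f xs + sumMap g xs
sumMap-+ f g []       = sym (ℚₚ.+-identityˡ _)
sumMap-+ f g (x ∷ xs) = trans (cong (f x + g x +_) (sumMap-+ f g xs)) (interchange (f x) (g x) _ _)

sumMap-*ˡ : (c : ℚ) (f : X → ℚ) (xs : List X) → sumMap (λ x → c * f x) xs ≡ c * sumMap f xs
sumMap-*ˡ c f []       = sym (ℚₚ.*-zeroʳ c)
sumMap-*ˡ c f (x ∷ xs) = trans (cong (c * f x +_) (sumMap-*ˡ c f xs)) (sym (ℚₚ.*-distribˡ-+ c (f x) _))

sumMap-map : (f : Y → ℚ) (g : X → Y) (xs : List X) → sumMap f (map g xs) ≡ sumMap (f ∘ g) xs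
sumMap-map f g []       = refl
sumMap-map f g (x ∷ xs) = cong (f (g x) +_) (sumMap-map f g xs)

sumMap-concatMap : (f : Y → ℚ) (g : X → List Y) (xs : List X) →
  sumMap f (concatMap g xs) ≡ sumMap (sumMap f ∘ g) xs
sumMap-concatMap f g []       = refl
sumMap-concatMap f g (x ∷ xs) =
  trans (sumMap-++ f (g x) (concatMap g xs)) (cong (sumMap f (g x) +_) (sumMap-concatMap f g xs))

sumMap-comm : (f : X → Y → ℚ) (xs : List X) (ys : List Y) →
  sumMap (λ x → sumMap (f x) ys) xs ≡ sumMap (λ y → sumMap (λ x → f x y) xs) ys
sumMap-comm f []       ys = sym (sumMap-zero ys)
sumMap-comm f (x ∷ xs) ys =
  trans (cong (sumMap (f x) ys +_) (sumMap-comm f xs ys)) (sym (sumMap-+ (f x) _ ys))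

partialSum-cong : {f g : ℕ → ℚ} (n : ℕ) → (∀ i → i < n → f i ≡ g i) → partialSum f n ≡ partialSum g n
partialSum-cong zero    f≗g = refl
partialSum-cong (suc n) f≗g = cong₂ _+_ (partialSum-cong n (λ i i<n → f≗g i (ℕₚ.m<n⇒m<1+n i<n))) (f≗g n ℕₚ.≤-refl)

partialSum-zero : {f : ℕ → ℚ} (n : ℕ) → (∀ i → i < n → f i ≡ 0ℚ) → partialSum f n ≡ 0ℚ
partialSum-zero n f≗0 = trans (partialSum-cong n f≗0) (zeros n)
  where
  zeros : ∀ n → partialSum (λ _ → 0ℚ) n ≡ 0ℚ
  zeros zero    = refl
  zeros (suc n) = cong (_+ 0ℚ) (zeros n)

partialSum-+ : (f g : ℕ → ℚ) (n : ℕ) → partialSum (λ i → f i + g i) n ≡ partialSum f n + partialSum g n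
partialSum-+ f g zero    = refl
partialSum-+ f g (suc n) =
  trans (cong (_+ (f n + g n)) (partialSum-+ f g n)) (interchange (partialSum f n) (partialSum g n) (f n) (g n))

partialSum-*ˡ : (c : ℚ) (f : ℕ → ℚ) (n : ℕ) → partialSum (λ i → c * f i) n ≡ c * partialSum f n
partialSum-*ˡ c f zero    = sym (ℚₚ.*-zeroʳ c)
partialSum-*ˡ c f (suc n) = trans (cong (_+ c * f n) (partialSum-*ˡ c f n)) (sym (ℚₚ.*-distribˡ-+ c _ (f n)))

partialSum-*ʳ : (f : ℕ → ℚ) (c : ℚ) (n : ℕ) → partialSum (λ i → f i * c) n ≡ partialSum f n * c
partialSum-*ʳ f c zero    = sym (ℚₚ.*-zeroˡ c)
partialSum-*ʳ f c (suc n) =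
  trans (cong (_+ f n * c) (partialSum-*ʳ f c n)) (sym (ℚₚ.*-distribʳ-+ c (partialSum f n) (f n)))

partialSum-sumMap : (f : ℕ → X → ℚ) (n : ℕ) (xs : List X) →
  partialSum (λ i → sumMap (f i) xs) n ≡ sumMap (λ x → partialSum (λ i → f i x) n) xs
partialSum-sumMap f zero    xs = sym (sumMap-zero xs)
partialSum-sumMap f (suc n) xs =
  trans (cong (_+ sumMap (f n) xs) (partialSum-sumMap f n xs)) (sym (sumMap-+ _ (f n) xs))

partialSum-suc : (f : ℕ → ℚ) (n : ℕ) → partialSum f (suc n) ≡ f 0 + partialSum (f ∘ suc) n
partialSum-suc f zero    = ℚₚ.+-comm 0ℚ (f 0)
partialSum-suc f (suc n) = trans (cong (_+ f (suc n)) (partialSum-suc f n)) (ℚₚ.+-assoc (f 0) _ _)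

partialSum-reverse : (f : ℕ → ℚ) (n : ℕ) → partialSum f (suc n) ≡ partialSum (λ i → f (n ∸ i)) (suc n)
partialSum-reverse f zero    = refl
partialSum-reverse f (suc n) = begin
  partialSum f (suc n) + f (suc n)                    ≡⟨ cong (_+ f (suc n)) (partialSum-reverse f n) ⟩
  partialSum (λ i → f (n ∸ i)) (suc n) + f (suc n)    ≡⟨ ℚₚ.+-comm _ (f (suc n)) ⟩
  f (suc n) + partialSum (λ i → f (n ∸ i)) (suc n)    ≡⟨ partialSum-suc (λ i → f (suc n ∸ i)) (suc n) ⟨
  partialSum (λ i → f (suc n ∸ i)) (suc (suc n))      ∎
  where open ≡-Reasoning

sumMap-upTo : (f : ℕ → ℚ) (n : ℕ) → sumMap f (upTo n) ≡ partialSum f n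
sumMap-upTo f = sumMap-applyUpTo id
  where
  sumMap-applyUpTo : (g : ℕ → ℕ) (n : ℕ) → sumMap f (applyUpTo g n) ≡ partialSum (f ∘ g) n
  sumMap-applyUpTo g zero    = refl
  sumMap-applyUpTo g (suc n) = trans (cong (f (g 0) +_) (sumMap-applyUpTo (g ∘ suc) n)) (sym (partialSum-suc (f ∘ g) n))

partialSum-stable : (f : ℕ → ℚ) {m n : ℕ} → m ≤ n → (∀ i → m ≤ i → i < n → f i ≡ 0ℚ) →
  partialSum f n ≡ partialSum f m
partialSum-stable f {n = zero}  z≤n  _   = refl
partialSum-stable f {m} {suc n} m≤1+n f≗0 with ℕₚ.m≤n⇒m<n∨m≡n m≤1+n
... | inj₂ refl = refl
... | inj₁ m<1+n = begin
  partialSum f n + f n   ≡⟨ cong₂ _+_ (partialSum-stable f m≤n (λ i m≤i i<n → f≗0 i m≤i (ℕₚ.m<n⇒m<1+n i<n)))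
                                      (f≗0 n m≤n ℕₚ.≤-refl) ⟩
  partialSum f m + 0ℚ    ≡⟨ ℚₚ.+-identityʳ _ ⟩
  partialSum f m         ∎
  where
  open ≡-Reasoning
  m≤n = ℕₚ.≤-pred m<1+n

partialSum-single : (f : ℕ → ℚ) {n k : ℕ} → k < n → (∀ i → i < n → i ≢ k → f i ≡ 0ℚ) → partialSum f n ≡ f k
partialSum-single f {suc n} {k} k<1+n f≗0 = begin
  partialSum f (suc n)  ≡⟨ partialSum-stable f k<1+n (λ i k<i i<1+n → f≗0 i i<1+n (ℕₚ.<⇒≢ k<i ∘ sym)) ⟩
  partialSum f (suc k)  ≡⟨ cong (_+ f k) (partialSum-zero k (λ i i<k → f≗0 i (ℕₚ.<-trans i<k k<1+n) (ℕₚ.<⇒≢ i<k))) ⟩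
  0ℚ + f k              ≡⟨ ℚₚ.+-identityˡ (f k) ⟩
  f k                   ∎
  where open ≡-Reasoning

∧-trueˡ : ∀ {a b} → (a ∧ b) ≡ true → a ≡ true
∧-trueˡ {true} _ = refl

∧-trueʳ : ∀ {a b} → (a ∧ b) ≡ true → b ≡ true
∧-trueʳ {true} b≡true = b≡true

∧-true : ∀ {a b} → a ≡ true → b ≡ true → (a ∧ b) ≡ true
∧-true refl refl = refl

≡true-ext : ∀ {a b : Bool} → (a ≡ true → b ≡ true) → (b ≡ true → a ≡ true) → a ≡ b
≡true-ext {false} {false} _ _ = refl
≡true-ext {false} {true}  _ g = g refl
≡true-ext {true}  {false} f _ = sym (f refl)
≡true-ext {true}  {true}  _ _ = refl

T⇒≡true : ∀ {a} → T a → a ≡ true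
T⇒≡true {true} _ = refl

≡true⇒T : ∀ {a} → a ≡ true → T a
≡true⇒T refl = _

module _ {m n : ℕ} where

  ≤⇒≤ᵇ≡true : m ≤ n → (m ≤ᵇ n) ≡ true
  ≤⇒≤ᵇ≡true = T⇒≡true ∘ ℕₚ.≤⇒≤ᵇ

  ≤ᵇ≡true⇒≤ : (m ≤ᵇ n) ≡ true → m ≤ n
  ≤ᵇ≡true⇒≤ = ℕₚ.≤ᵇ⇒≤ m n ∘ ≡true⇒T

  ≰⇒≤ᵇ≡false : ¬ m ≤ n → (m ≤ᵇ n) ≡ false
  ≰⇒≤ᵇ≡false m≰n with m ≤ᵇ n in eq
  ... | true  = ⊥-elim (m≰n (≤ᵇ≡true⇒≤ eq))
  ... | false = refl

  ≤ᵇ≡false⇒≰ : (m ≤ᵇ n) ≡ false → ¬ m ≤ n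
  ≤ᵇ≡false⇒≰ eq m≤n with () ← trans (sym eq) (≤⇒≤ᵇ≡true m≤n)

  ≡⇒≡ᵇ≡true : m ≡ n → (m ≡ᵇ n) ≡ true
  ≡⇒≡ᵇ≡true = T⇒≡true ∘ ℕₚ.≡⇒≡ᵇ m n

  ≢⇒≡ᵇ≡false : m ≢ n → (m ≡ᵇ n) ≡ false
  ≢⇒≡ᵇ≡false m≢n with m ≡ᵇ n in eq
  ... | true  = ⊥-elim (m≢n (ℕₚ.≡ᵇ⇒≡ m n (≡true⇒T eq)))
  ... | false = refl

module _ {X : Set} {b : Bool} {x y : X} where

  if-true : b ≡ true → (if b then x else y) ≡ x
  if-true refl = refl

  if-false : b ≡ false → (if b then x else y) ≡ y
  if-false refl = refl

if-0 : ∀ b {x : ℚ} → (b ≡ true → x ≡ 0ℚ) → (if b then x else 0ℚ) ≡ 0ℚ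
if-0 true  x≡0 = x≡0 refl
if-0 false _   = refl

allBelow⇒ : ∀ n p → allBelow n p ≡ true → ∀ i → i < n → p i ≡ true
allBelow⇒ (suc n) p all i i<1+n with ℕₚ.m≤n⇒m<n∨m≡n i<1+n
... | inj₂ refl = ∧-trueʳ {allBelow n p} all
... | inj₁ i<n  = allBelow⇒ n p (∧-trueˡ all) i (ℕₚ.≤-pred i<n)

⇒allBelow : ∀ n p → (∀ i → i < n → p i ≡ true) → allBelow n p ≡ true
⇒allBelow zero    p _   = refl
⇒allBelow (suc n) p all = ∧-true (⇒allBelow n p (λ i i<n → all i (ℕₚ.m<n⇒m<1+n i<n))) (all n ℕₚ.≤-refl)

-- Strips as row-by-row conditions

hd : List ℕ → ℕ
hd []      = 0
hd (x ∷ _) = x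

tl : List ℕ → List ℕ
tl []       = []
tl (_ ∷ xs) = xs

RowCondition : Set
RowCondition = ℕ → ℕ → ℕ → Bool

vRow : RowCondition
vRow x a _ = (x ≤ᵇ a) ∧ (a ≤ᵇ suc x)

hRow : RowCondition
hRow x l l′ = (l′ ≤ᵇ x) ∧ (x ≤ᵇ l)

-- vstrip μ ν and hstrip μ ν are definitionally allRows vRow μ ν and allRows hRow μ ν.
allRows : RowCondition → List ℕ → List ℕ → Bool
allRows R μ ν = allBelow (suc (length μ ⊔ length ν)) (λ i → R (part μ i) (part ν i) (part ν (suc i)))

rowwise : RowCondition → List ℕ → List ℕ → Bool
rowwise R []      []      = true
rowwise R []      (y ∷ ν) = R 0 y (hd ν) ∧ rowwise R [] ν
rowwise R (x ∷ μ) []      = R x 0 0 ∧ rowwise R μ []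
rowwise R (x ∷ μ) (y ∷ ν) = R x y (hd ν) ∧ rowwise R μ ν

EveryRow : RowCondition → List ℕ → List ℕ → Set
EveryRow R μ ν = ∀ i → R (part μ i) (part ν i) (part ν (suc i)) ≡ true

part-zero : ∀ ν → part ν 0 ≡ hd ν
part-zero []      = refl
part-zero (x ∷ ν) = refl

part-beyond : ∀ μ {i} → length μ ≤ i → part μ i ≡ 0
part-beyond []      _           = refl
part-beyond (x ∷ μ) (s≤s μ≤i) = part-beyond μ μ≤i

module _ (R : RowCondition) (R000 : R 0 0 0 ≡ true) where

  rowwise⇒EveryRow : ∀ μ ν → rowwise R μ ν ≡ true → EveryRow R μ ν
  rowwise⇒EveryRow []      []      _  _       = R000
  rowwise⇒EveryRow []      (y ∷ ν) ok zero    = subst (λ z → R 0 y z ≡ true) (sym (part-zero ν)) (∧-trueˡ ok)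
  rowwise⇒EveryRow []      (y ∷ ν) ok (suc i) = rowwise⇒EveryRow [] ν (∧-trueʳ {R 0 y (hd ν)} ok) i
  rowwise⇒EveryRow (x ∷ μ) []      ok zero    = ∧-trueˡ ok
  rowwise⇒EveryRow (x ∷ μ) []      ok (suc i) = rowwise⇒EveryRow μ [] (∧-trueʳ {R x 0 0} ok) i
  rowwise⇒EveryRow (x ∷ μ) (y ∷ ν) ok zero    = subst (λ z → R x y z ≡ true) (sym (part-zero ν)) (∧-trueˡ ok)
  rowwise⇒EveryRow (x ∷ μ) (y ∷ ν) ok (suc i) = rowwise⇒EveryRow μ ν (∧-trueʳ {R x y (hd ν)} ok) i

  allRows⇒EveryRow : ∀ μ ν → allRows R μ ν ≡ true → EveryRow R μ ν
  allRows⇒EveryRow μ ν ok i with i ℕ.<? suc (length μ ⊔ length ν)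
  ... | yes i<bound = allBelow⇒ _ _ ok i i<bound
  ... | no  i≮bound =
    subst₂ (λ u v → R u v (part ν (suc i)) ≡ true) (sym (part-beyond μ μ≤i)) (sym (part-beyond ν ν≤i))
      (subst (λ z → R 0 0 z ≡ true) (sym (part-beyond ν (ℕₚ.m≤n⇒m≤1+n ν≤i))) R000)
    where
    bound≤i = ℕₚ.<⇒≤ (ℕₚ.≮⇒≥ i≮bound)
    μ≤i = ℕₚ.≤-trans (ℕₚ.m≤m⊔n (length μ) (length ν)) bound≤i
    ν≤i = ℕₚ.≤-trans (ℕₚ.m≤n⊔m (length μ) (length ν)) bound≤i

EveryRow⇒rowwise : ∀ R μ ν → EveryRow R μ ν → rowwise R μ ν ≡ true
EveryRow⇒rowwise R []      []      _   = refl
EveryRow⇒rowwise R []      (y ∷ ν) all =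
  ∧-true (subst (λ z → R 0 y z ≡ true) (part-zero ν) (all 0)) (EveryRow⇒rowwise R [] ν (all ∘ suc))
EveryRow⇒rowwise R (x ∷ μ) []      all = ∧-true (all 0) (EveryRow⇒rowwise R μ [] (all ∘ suc))
EveryRow⇒rowwise R (x ∷ μ) (y ∷ ν) all =
  ∧-true (subst (λ z → R x y z ≡ true) (part-zero ν) (all 0)) (EveryRow⇒rowwise R μ ν (all ∘ suc))

allRows≡rowwise : ∀ R → R 0 0 0 ≡ true → ∀ μ ν → allRows R μ ν ≡ rowwise R μ ν
allRows≡rowwise R R000 μ ν = ≡true-ext
  (EveryRow⇒rowwise R μ ν ∘ allRows⇒EveryRow R R000 μ ν)
  (λ ok → ⇒allBelow _ _ (λ i _ → rowwise⇒EveryRow R R000 μ ν ok i))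

rowwise-∷ : ∀ R x μ ν → rowwise R (x ∷ μ) ν ≡ (R x (hd ν) (hd (tl ν)) ∧ rowwise R μ (tl ν))
rowwise-∷ R x μ []      = refl
rowwise-∷ R x μ (y ∷ ν) = refl

rowwise-[] : ∀ R → R 0 0 0 ≡ true → ∀ ν → rowwise R [] ν ≡ (R 0 (hd ν) (hd (tl ν)) ∧ rowwise R [] (tl ν))
rowwise-[] R R000 []      = sym (cong (_∧ true) R000)
rowwise-[] R R000 (y ∷ ν) = refl

rowwise-size≤ : ∀ R → (∀ x a a′ → R x a a′ ≡ true → x ≤ a) → ∀ μ ν → rowwise R μ ν ≡ true → size μ ≤ size ν
rowwise-size≤ R R⇒≤ []      ν       _  = z≤n
rowwise-size≤ R R⇒≤ (x ∷ μ) []      ok =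
  ℕₚ.+-mono-≤ (R⇒≤ x 0 0 (∧-trueˡ ok)) (rowwise-size≤ R R⇒≤ μ [] (∧-trueʳ {R x 0 0} ok))
rowwise-size≤ R R⇒≤ (x ∷ μ) (y ∷ ν) ok =
  ℕₚ.+-mono-≤ (R⇒≤ x y (hd ν) (∧-trueˡ ok)) (rowwise-size≤ R R⇒≤ μ ν (∧-trueʳ {R x y (hd ν)} ok))

vRow⇒≤ : ∀ x a a′ → vRow x a a′ ≡ true → x ≤ a
vRow⇒≤ x a a′ ok = ≤ᵇ≡true⇒≤ (∧-trueˡ ok)

hRow⇒≤ : ∀ x l l′ → hRow x l l′ ≡ true → x ≤ l
hRow⇒≤ x l l′ ok = ≤ᵇ≡true⇒≤ (∧-trueʳ {l′ ≤ᵇ x} ok)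

vstrip≡rowwise : ∀ μ ν → vstrip μ ν ≡ rowwise vRow μ ν
vstrip≡rowwise = allRows≡rowwise vRow refl

hstrip≡rowwise : ∀ μ λ′ → hstrip μ λ′ ≡ rowwise hRow μ λ′
hstrip≡rowwise = allRows≡rowwise hRow refl

Positive : List ℕ → Set
Positive = All (1 ≤_)

1≤head : ∀ {y ν} → IsPartition (y ∷ ν) → 1 ≤ y
1≤head (one 1≤y)      = 1≤y
1≤head (cons ν≤y ptn) = ℕₚ.≤-trans (1≤head ptn) ν≤y

IsPartition-tl : ∀ {y ν} → IsPartition (y ∷ ν) → IsPartition ν
IsPartition-tl (one _)      = nil
IsPartition-tl (cons _ ptn) = ptn

hd≤head : ∀ {y ν} → IsPartition (y ∷ ν) → hd ν ≤ y
hd≤head (one _)      = z≤n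
hd≤head (cons ν≤y _) = ν≤y

IsPartition⇒Positive : ∀ {α} → IsPartition α → Positive α
IsPartition⇒Positive nil            = []
IsPartition⇒Positive (one 1≤x)      = 1≤x ∷ []
IsPartition⇒Positive ptn@(cons _ p) = 1≤head ptn ∷ IsPartition⇒Positive p

sumParts : ℕ → ℕ → ℕ → (List ℕ → ℚ) → ℚ
sumParts fuel n b F = sumMap F (partsF fuel n b)

sumParts-suc : ∀ fuel n b F → sumParts (suc fuel) (suc n) b F ≡
  partialSum (λ i → sumParts fuel (n ∸ i) (suc i) (F ∘ (suc i ∷_))) (b ⊓ suc n)
sumParts-suc fuel n b F = begin
  sumMap F (concatMap (λ i → map (suc i ∷_) (parts i)) (upTo (b ⊓ suc n)))
    ≡⟨ sumMap-concatMap F (λ i → map (suc i ∷_) (parts i)) (upTo (b ⊓ suc n)) ⟩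
  sumMap (λ i → sumMap F (map (suc i ∷_) (parts i))) (upTo (b ⊓ suc n))
    ≡⟨ sumMap-cong (upTo (b ⊓ suc n)) (λ i → sumMap-map F (suc i ∷_) (parts i)) ⟩
  sumMap (λ i → sumMap (F ∘ (suc i ∷_)) (parts i)) (upTo (b ⊓ suc n))
    ≡⟨ sumMap-upTo _ (b ⊓ suc n) ⟩
  partialSum (λ i → sumParts fuel (n ∸ i) (suc i) (F ∘ (suc i ∷_))) (b ⊓ suc n) ∎
  where
  open ≡-Reasoning
  parts : ℕ → List (List ℕ)
  parts i = partsF fuel (n ∸ i) (suc i)

partsF-fuel : ∀ fuel fuel′ n b → n ≤ fuel → n ≤ fuel′ → partsF fuel n b ≡ partsF fuel′ n b
partsF-fuel _          _           zero    b _         _          = refl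
partsF-fuel (suc fuel) (suc fuel′) (suc n) b (s≤s n≤f) (s≤s n≤f′) =
  cong concat (Listₚ.map-cong (λ i → cong (map (suc i ∷_)) (partsF-fuel fuel fuel′ (n ∸ i) (suc i)
    (ℕₚ.≤-trans (ℕₚ.m∸n≤m n i) n≤f) (ℕₚ.≤-trans (ℕₚ.m∸n≤m n i) n≤f′))) (upTo (b ⊓ suc n)))

partsF-bound : ∀ fuel n b → n ≤ b → partsF fuel n b ≡ partsF fuel n n
partsF-bound fuel       zero    b _   = refl
partsF-bound zero       (suc n) b _   = refl
partsF-bound (suc fuel) (suc n) b n≤b =
  cong (λ k → concatMap (λ i → map (suc i ∷_) (partsF fuel (n ∸ i) (suc i))) (upTo k))
    (trans (ℕₚ.m≥n⇒m⊓n≡n n≤b) (sym (ℕₚ.⊓-idem (suc n))))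

private
  i<b⊓1+n⇒i≤n : ∀ {i b n} → i < b ⊓ suc n → i ≤ n
  i<b⊓1+n⇒i≤n {b = b} i< = ℕₚ.≤-pred (ℕₚ.≤-trans i< (ℕₚ.m⊓n≤n b _))

  size-∷ : ∀ {i n} μ → i ≤ n → size μ ≡ n ∸ i → size (suc i ∷ μ) ≡ suc n
  size-∷ {i} μ i≤n size≡ = cong suc (trans (cong (i ℕ.+_) size≡) (ℕₚ.m+[n∸m]≡n i≤n))

sumParts-cong : ∀ fuel n b {F G : List ℕ → ℚ} → (∀ μ → Positive μ → size μ ≡ n → F μ ≡ G μ) →
  sumParts fuel n b F ≡ sumParts fuel n b G
sumParts-cong fuel       zero    b F≗G = cong (_+ 0ℚ) (F≗G [] [] refl)
sumParts-cong zero       (suc n) b F≗G = refl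
sumParts-cong (suc fuel) (suc n) b {F} {G} F≗G = begin
  sumParts (suc fuel) (suc n) b F                                           ≡⟨ sumParts-suc fuel n b F ⟩
  partialSum (λ i → sumParts fuel (n ∸ i) (suc i) (F ∘ (suc i ∷_))) (b ⊓ suc n) ≡⟨ partialSum-cong _ rows ⟩
  partialSum (λ i → sumParts fuel (n ∸ i) (suc i) (G ∘ (suc i ∷_))) (b ⊓ suc n) ≡⟨ sumParts-suc fuel n b G ⟨
  sumParts (suc fuel) (suc n) b G                                           ∎
  where
  open ≡-Reasoning
  rows : ∀ i → i < b ⊓ suc n →
    sumParts fuel (n ∸ i) (suc i) (F ∘ (suc i ∷_)) ≡ sumParts fuel (n ∸ i) (suc i) (G ∘ (suc i ∷_))
  rows i i< = sumParts-cong fuel (n ∸ i) (suc i)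
    (λ μ pos size≡ → F≗G (suc i ∷ μ) (s≤s z≤n ∷ pos) (size-∷ μ (i<b⊓1+n⇒i≤n {b = b} i<) size≡))

sumParts-zero : ∀ fuel n b {F : List ℕ → ℚ} → (∀ μ → Positive μ → size μ ≡ n → F μ ≡ 0ℚ) →
  sumParts fuel n b F ≡ 0ℚ
sumParts-zero fuel n b F≗0 = trans (sumParts-cong fuel n b F≗0) (sumMap-zero (partsF fuel n b))

sumParts-single : ∀ fuel n b (F : List ℕ → ℚ) ν → n ≤ fuel → IsPartition ν → size ν ≡ n → hd ν ≤ b →
  (∀ μ → Positive μ → size μ ≡ n → μ ≢ ν → F μ ≡ 0ℚ) → sumParts fuel n b F ≡ F ν
sumParts-single fuel zero b F [] _ _ _ _ _ = ℚₚ.+-identityʳ _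
sumParts-single fuel zero b F (y ∷ ν) _ ptn size≡0 _ _ =
  ⊥-elim (ℕₚ.<-irrefl refl (ℕₚ.≤-trans (1≤head ptn) (ℕₚ.≤-trans (ℕₚ.m≤m+n y (size ν)) (ℕₚ.≤-reflexive size≡0))))
sumParts-single (suc fuel) (suc n) b F (zero ∷ ν) _ ptn _ _ _ = ⊥-elim (ℕₚ.<-irrefl refl (1≤head ptn))
sumParts-single (suc fuel) (suc n) b F (suc k ∷ ν) (s≤s n≤fuel) ptn size≡ k<b others = begin
  sumParts (suc fuel) (suc n) b F                                               ≡⟨ sumParts-suc fuel n b F ⟩
  partialSum (λ i → sumParts fuel (n ∸ i) (suc i) (F ∘ (suc i ∷_))) (b ⊓ suc n)
    ≡⟨ partialSum-single _ (ℕₚ.⊓-glb k<b (s≤s k≤n)) otherRows ⟩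
  sumParts fuel (n ∸ k) (suc k) (F ∘ (suc k ∷_))
    ≡⟨ sumParts-single fuel (n ∸ k) (suc k) (F ∘ (suc k ∷_)) ν (ℕₚ.≤-trans (ℕₚ.m∸n≤m n k) n≤fuel)
         (IsPartition-tl ptn) size-ν (hd≤head ptn)
         (λ μ pos size≡ μ≢ν → others (suc k ∷ μ) (s≤s z≤n ∷ pos) (size-∷ μ k≤n size≡) (μ≢ν ∘ Listₚ.∷-injectiveʳ)) ⟩
  F (suc k ∷ ν)                                                                 ∎
  where
  open ≡-Reasoning
  k≤n : k ≤ n
  k≤n = ℕₚ.≤-trans (ℕₚ.m≤m+n k (size ν)) (ℕₚ.≤-pred (ℕₚ.≤-reflexive size≡))
  size-ν : size ν ≡ n ∸ k
  size-ν = trans (sym (ℕₚ.m+n∸m≡n k (size ν))) (cong (_∸ k) (ℕₚ.suc-injective size≡))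
  otherRows : ∀ i → i < b ⊓ suc n → i ≢ k → sumParts fuel (n ∸ i) (suc i) (F ∘ (suc i ∷_)) ≡ 0ℚ
  otherRows i i< i≢k = sumParts-zero fuel (n ∸ i) (suc i)
    (λ μ pos size≡ → others (suc i ∷ μ) (s≤s z≤n ∷ pos) (size-∷ μ (i<b⊓1+n⇒i≤n {b = b} i<) size≡)
                            (i≢k ∘ ℕₚ.suc-injective ∘ Listₚ.∷-injectiveˡ))

-- Σ F μ over the partitions μ with |μ| ≤ N and largest part ≤ b.
sumPartitions : ℕ → ℕ → (List ℕ → ℚ) → ℚ
sumPartitions N b F = partialSum (λ n → sumParts n n b F) (suc N)

partialSum-triangle : ∀ b (G : ℕ → ℕ → ℚ) N →
  partialSum (λ n → partialSum (λ i → G i (n ∸ i)) (b ⊓ suc n)) N ≡ partialSum (λ i → partialSum (G i) (N ∸ i)) (b ⊓ N)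
partialSum-triangle b G zero    = cong (partialSum _) (sym (ℕₚ.⊓-zeroʳ b))
partialSum-triangle b G (suc N) = begin
  partialSum (λ n → partialSum (λ i → G i (n ∸ i)) (b ⊓ suc n)) N + partialSum diagonal (b ⊓ suc N)
    ≡⟨ cong (_+ partialSum diagonal (b ⊓ suc N)) (partialSum-triangle b G N) ⟩
  partialSum (λ i → partialSum (G i) (N ∸ i)) (b ⊓ N) + partialSum diagonal (b ⊓ suc N)
    ≡⟨ cong (_+ partialSum diagonal (b ⊓ suc N))
         (partialSum-stable _ (ℕₚ.⊓-monoʳ-≤ b (ℕₚ.n≤1+n N)) emptyColumn) ⟨
  partialSum (λ i → partialSum (G i) (N ∸ i)) (b ⊓ suc N) + partialSum diagonal (b ⊓ suc N)
    ≡⟨ partialSum-+ (λ i → partialSum (G i) (N ∸ i)) diagonal (b ⊓ suc N) ⟨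
  partialSum (λ i → partialSum (G i) (suc (N ∸ i))) (b ⊓ suc N)
    ≡⟨ partialSum-cong _ (λ i i< → cong (partialSum (G i)) (sym (ℕₚ.+-∸-assoc 1 (i<b⊓1+n⇒i≤n {b = b} i<)))) ⟩
  partialSum (λ i → partialSum (G i) (suc N ∸ i)) (b ⊓ suc N) ∎
  where
  open ≡-Reasoning
  diagonal : ℕ → ℚ
  diagonal i = G i (N ∸ i)
  emptyColumn : ∀ i → b ⊓ N ≤ i → i < b ⊓ suc N → partialSum (G i) (N ∸ i) ≡ 0ℚ
  emptyColumn i b⊓N≤i i< = cong (partialSum (G i)) (ℕₚ.m≤n⇒m∸n≡0 (ℕₚ.≮⇒≥ i≮N))
    where
    i≮N : ¬ i < N
    i≮N i<N = ℕₚ.<⇒≱ (ℕₚ.⊓-glb (ℕₚ.<-≤-trans i< (ℕₚ.m⊓n≤m b (suc N))) i<N) b⊓N≤i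

sumPartitions-firstRow : ∀ N b F →
  sumPartitions N b F ≡ F [] + partialSum (λ i → sumPartitions (N ∸ suc i) (suc i) (F ∘ (suc i ∷_))) (b ⊓ N)
sumPartitions-firstRow N b F = begin
  partialSum (λ n → sumParts n n b F) (suc N)
    ≡⟨ partialSum-suc (λ n → sumParts n n b F) N ⟩
  (F [] + 0ℚ) + partialSum (λ n → sumParts (suc n) (suc n) b F) N
    ≡⟨ cong₂ _+_ (ℚₚ.+-identityʳ (F [])) (partialSum-cong N (λ n _ → sumParts-suc n n b F)) ⟩
  F [] + partialSum (λ n → partialSum (λ i → sumParts n (n ∸ i) (suc i) (F ∘ (suc i ∷_))) (b ⊓ suc n)) N
    ≡⟨ cong (F [] +_) (partialSum-cong N (λ n _ → partialSum-cong (b ⊓ suc n) (λ i _ →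
         cong (sumMap (F ∘ (suc i ∷_))) (partsF-fuel n (n ∸ i) (n ∸ i) (suc i) (ℕₚ.m∸n≤m n i) ℕₚ.≤-refl)))) ⟩
  F [] + partialSum (λ n → partialSum (λ i → G i (n ∸ i)) (b ⊓ suc n)) N
    ≡⟨ cong (F [] +_) (partialSum-triangle b G N) ⟩
  F [] + partialSum (λ i → partialSum (G i) (N ∸ i)) (b ⊓ N)
    ≡⟨ cong (F [] +_) (partialSum-cong (b ⊓ N) (λ i i< →
         cong (partialSum (G i)) (ℕₚ.+-∸-assoc 1 (ℕₚ.<-≤-trans i< (ℕₚ.m⊓n≤n b N))))) ⟩
  F [] + partialSum (λ i → sumPartitions (N ∸ suc i) (suc i) (F ∘ (suc i ∷_))) (b ⊓ N) ∎
  where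
  open ≡-Reasoning
  G : ℕ → ℕ → ℚ
  G i r = sumParts r r (suc i) (F ∘ (suc i ∷_))

sumPartitions-cong : ∀ N b {F G : List ℕ → ℚ} → (∀ μ → F μ ≡ G μ) → sumPartitions N b F ≡ sumPartitions N b G
sumPartitions-cong N b F≗G = partialSum-cong (suc N) (λ n _ → sumMap-cong (partsF n n b) F≗G)

sumPartitions-*ˡ : ∀ N b c F → sumPartitions N b (λ μ → c * F μ) ≡ c * sumPartitions N b F
sumPartitions-*ˡ N b c F =
  trans (partialSum-cong (suc N) (λ n _ → sumMap-*ˡ c F (partsF n n b))) (partialSum-*ˡ c _ (suc N))

sumPartitions-bound0 : ∀ N F → sumPartitions N 0 F ≡ F []
sumPartitions-bound0 N F = trans (sumPartitions-firstRow N 0 F) (ℚₚ.+-identityʳ (F []))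

-- The signed count of intermediate partitions is a product over rows

sgn-suc : ∀ n → sgn (suc n) ≡ - sgn n
sgn-suc zero          = refl
sgn-suc (suc zero)    = refl
sgn-suc (suc (suc n)) = sgn-suc n

sgn-+ : ∀ m n → sgn (m ℕ.+ n) ≡ sgn m * sgn n
sgn-+ zero    n = sym (ℚₚ.*-identityˡ (sgn n))
sgn-+ (suc m) n = begin
  sgn (suc (m ℕ.+ n))  ≡⟨ sgn-suc (m ℕ.+ n) ⟩
  - sgn (m ℕ.+ n)      ≡⟨ cong -_ (sgn-+ m n) ⟩
  - (sgn m * sgn n)    ≡⟨ ℚₚ.neg-distribˡ-* (sgn m) (sgn n) ⟩
  - sgn m * sgn n      ≡⟨ cong (_* sgn n) (sgn-suc m) ⟨
  sgn (suc m) * sgn n  ∎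
  where open ≡-Reasoning

weight : List ℕ → List ℕ → List ℕ → ℚ
weight α λ′ μ = if rowwise vRow μ α then (if rowwise hRow μ λ′ then sgn (size α ∸ size μ) else 0ℚ) else 0ℚ

weight-vanishes : ∀ α λ′ μ → ¬ size μ ≤ size λ′ → weight α λ′ μ ≡ 0ℚ
weight-vanishes α λ′ μ μ≰λ′ with rowwise hRow μ λ′ in hstrip-ok
... | true  = ⊥-elim (μ≰λ′ (rowwise-size≤ hRow hRow⇒≤ μ λ′ hstrip-ok))
... | false with rowwise vRow μ α
...   | true  = refl
...   | false = refl

keepRow : ℕ → ℕ → ℕ → ℚ
keepRow a l l′ = if hRow a l l′ then 1ℚ else 0ℚ

dropRow : ℕ → ℕ → ℕ → ℚ
dropRow zero    l l′ = 0ℚ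
dropRow (suc k) l l′ = if hRow k l l′ then - 1ℚ else 0ℚ

rowFactor : ℕ → ℕ → ℕ → ℚ
rowFactor a l l′ = keepRow a l l′ + dropRow a l l′

rowProduct : List ℕ → List ℕ → ℚ
rowProduct []      []       = 1ℚ
rowProduct []      (l ∷ λ′) = rowFactor 0 l (hd λ′) * rowProduct [] λ′
rowProduct (a ∷ α) []       = rowFactor a 0 0 * rowProduct α []
rowProduct (a ∷ α) (l ∷ λ′) = rowFactor a l (hd λ′) * rowProduct α λ′

rowProduct-step : ∀ α λ′ → rowProduct α λ′ ≡ rowFactor (hd α) (hd λ′) (hd (tl λ′)) * rowProduct (tl α) (tl λ′)
rowProduct-step []      []       = refl
rowProduct-step []      (l ∷ λ′) = refl
rowProduct-step (a ∷ α) []       = refl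
rowProduct-step (a ∷ α) (l ∷ λ′) = refl

-- The factor of the weight contributed by row i, with (a, l, l′, x) = (αᵢ, λ′ᵢ, λ′ᵢ₊₁, μᵢ).
rowTerm : ℕ → ℕ → ℕ → ℕ → ℚ
rowTerm a l l′ x = if vRow x a 0 ∧ hRow x l l′ then sgn (a ∸ x) else 0ℚ

hd≤size : ∀ α → hd α ≤ size α
hd≤size []      = z≤n
hd≤size (x ∷ α) = ℕₚ.m≤m+n x (size α)

size-hd-tl : ∀ α → size α ≡ hd α ℕ.+ size (tl α)
size-hd-tl []      = refl
size-hd-tl (x ∷ α) = refl

[m+n]∸[o+p]≡[m∸o]+[n∸p] : ∀ m n {o p} → o ≤ m → p ≤ n → (m ℕ.+ n) ∸ (o ℕ.+ p) ≡ (m ∸ o) ℕ.+ (n ∸ p)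
[m+n]∸[o+p]≡[m∸o]+[n∸p] m n {o} {p} o≤m p≤n = begin
  (m ℕ.+ n) ∸ (o ℕ.+ p)  ≡⟨ ℕₚ.∸-+-assoc (m ℕ.+ n) o p ⟨
  (m ℕ.+ n) ∸ o ∸ p      ≡⟨ cong (_∸ p) (ℕₚ.+-∸-comm n o≤m) ⟩
  ((m ∸ o) ℕ.+ n) ∸ p    ≡⟨ ℕₚ.+-∸-assoc (m ∸ o) p≤n ⟩
  (m ∸ o) ℕ.+ (n ∸ p)    ∎
  where open ≡-Reasoning

if-product : ∀ (b₁ b₂ b₃ b₄ : Bool) {s t u : ℚ} → (b₁ ≡ true → b₂ ≡ true → s ≡ t * u) →
  (if b₁ ∧ b₂ then (if b₃ ∧ b₄ then s else 0ℚ) else 0ℚ)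
    ≡ (if b₁ ∧ b₃ then t else 0ℚ) * (if b₂ then (if b₄ then u else 0ℚ) else 0ℚ)
if-product false b₂    b₃    b₄    {u = u} _ = sym (ℚₚ.*-zeroˡ (if b₂ then (if b₄ then u else 0ℚ) else 0ℚ))
if-product true  false false b₄    _         = sym (ℚₚ.*-zeroˡ 0ℚ)
if-product true  false true  b₄    {t = t} _ = sym (ℚₚ.*-zeroʳ t)
if-product true  true  false b₄    {u = u} _ = sym (ℚₚ.*-zeroˡ (if b₄ then u else 0ℚ))
if-product true  true  true  false {t = t} _ = sym (ℚₚ.*-zeroʳ t)
if-product true  true  true  true  s≡tu = s≡tu refl refl

weight-∷ : ∀ α λ′ x μ → weight α λ′ (x ∷ μ) ≡ rowTerm (hd α) (hd λ′) (hd (tl λ′)) x * weight (tl α) (tl λ′) μ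
weight-∷ α λ′ x μ rewrite rowwise-∷ vRow x μ α | rowwise-∷ hRow x μ λ′ =
  if-product (vRow x (hd α) 0) (rowwise vRow μ (tl α)) (hRow x (hd λ′) (hd (tl λ′))) (rowwise hRow μ (tl λ′))
    λ x-ok μ-ok → begin
      sgn (size α ∸ (x ℕ.+ size μ))                  ≡⟨ cong (λ n → sgn (n ∸ (x ℕ.+ size μ))) (size-hd-tl α) ⟩
      sgn ((hd α ℕ.+ size (tl α)) ∸ (x ℕ.+ size μ))  ≡⟨ cong sgn ([m+n]∸[o+p]≡[m∸o]+[n∸p] (hd α) (size (tl α))
                                                          (vRow⇒≤ x (hd α) 0 x-ok)
                                                          (rowwise-size≤ vRow vRow⇒≤ μ (tl α) μ-ok)) ⟩
      sgn ((hd α ∸ x) ℕ.+ (size (tl α) ∸ size μ))    ≡⟨ sgn-+ (hd α ∸ x) (size (tl α) ∸ size μ) ⟩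
      sgn (hd α ∸ x) * sgn (size (tl α) ∸ size μ)    ∎
  where open ≡-Reasoning

weight-[] : ∀ α λ′ → weight α λ′ [] ≡ rowTerm (hd α) (hd λ′) (hd (tl λ′)) 0 * weight (tl α) (tl λ′) []
weight-[] α λ′ rewrite rowwise-[] vRow refl α | rowwise-[] hRow refl λ′ =
  if-product (vRow 0 (hd α) 0) (rowwise vRow [] (tl α)) (hRow 0 (hd λ′) (hd (tl λ′))) (rowwise hRow [] (tl λ′))
    λ _ _ → trans (cong sgn (size-hd-tl α)) (sgn-+ (hd α) (size (tl α)))

pointMass : ℕ → ℚ → ℕ → ℚ
pointMass k h x = if x ≡ᵇ k then h else 0ℚ

pointMass-self : ∀ k h → pointMass k h k ≡ h
pointMass-self k h = cong (if_then h else 0ℚ) (≡⇒≡ᵇ≡true {k} refl)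

pointMass-other : ∀ {k x} h → x ≢ k → pointMass k h x ≡ 0ℚ
pointMass-other h x≢k = cong (if_then h else 0ℚ) (≢⇒≡ᵇ≡false x≢k)

partialSum-pointMass : ∀ k h K → k < K ⊎ h ≡ 0ℚ → partialSum (pointMass k h) K ≡ h
partialSum-pointMass k h K (inj₁ k<K) =
  trans (partialSum-single _ k<K (λ i _ → pointMass-other h)) (pointMass-self k h)
partialSum-pointMass k h K (inj₂ refl) = partialSum-zero K (λ i _ → if-0 (i ≡ᵇ k) (λ _ → refl))

dropMass : ℕ → ℕ → ℕ → ℕ → ℚ
dropMass zero    l l′ = λ _ → 0ℚ
dropMass (suc k) l l′ = pointMass k (dropRow (suc k) l l′)

module _ (l l′ : ℕ) where

  rowTerm-self : ∀ a → rowTerm a l l′ a ≡ keepRow a l l′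
  rowTerm-self a = cong₂ (λ b n → if b ∧ hRow a l l′ then sgn n else 0ℚ)
    (∧-true (≤⇒≤ᵇ≡true (ℕₚ.≤-refl {a})) (≤⇒≤ᵇ≡true (ℕₚ.n≤1+n a))) (ℕₚ.n∸n≡0 a)

  rowTerm-pred : ∀ k → rowTerm (suc k) l l′ k ≡ dropRow (suc k) l l′
  rowTerm-pred k = cong₂ (λ b n → if b ∧ hRow k l l′ then sgn n else 0ℚ)
    (∧-true (≤⇒≤ᵇ≡true (ℕₚ.n≤1+n k)) (≤⇒≤ᵇ≡true (ℕₚ.≤-refl {suc k})))
    (trans (ℕₚ.+-∸-assoc 1 (ℕₚ.≤-refl {k})) (cong suc (ℕₚ.n∸n≡0 k)))

  rowTerm-far : ∀ {a x} → x ≢ a → suc x ≢ a → rowTerm a l l′ x ≡ 0ℚ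
  rowTerm-far {a} {x} x≢a 1+x≢a with x ≤ᵇ a in x≤ᵇa
  ... | false = refl
  ... | true  = cong (λ b → if b ∧ hRow x l l′ then sgn (a ∸ x) else 0ℚ) (≰⇒≤ᵇ≡false a≰1+x)
    where
    a≰1+x : ¬ a ≤ suc x
    a≰1+x a≤1+x = 1+x≢a (ℕₚ.≤-antisym (ℕₚ.≤∧≢⇒< (≤ᵇ≡true⇒≤ x≤ᵇa) x≢a) a≤1+x)

  dropMass-far : ∀ {a x} → suc x ≢ a → dropMass a l l′ x ≡ 0ℚ
  dropMass-far {zero}  _       = refl
  dropMass-far {suc k} 1+x≢a = pointMass-other _ (1+x≢a ∘ cong suc)

  rowTerm-split : ∀ a x → rowTerm a l l′ x ≡ pointMass a (keepRow a l l′) x + dropMass a l l′ x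
  rowTerm-split a x with x ℕₚ.≟ a
  ... | yes refl = begin
    rowTerm x l l′ x                                       ≡⟨ rowTerm-self x ⟩
    keepRow x l l′                                         ≡⟨ ℚₚ.+-identityʳ _ ⟨
    keepRow x l l′ + 0ℚ                                    ≡⟨ cong₂ _+_ (pointMass-self x _) (dropMass-far {x} {x} ℕₚ.1+n≢n) ⟨
    pointMass x (keepRow x l l′) x + dropMass x l l′ x     ∎
    where open ≡-Reasoning
  ... | no x≢a with suc x ℕₚ.≟ a
  ...   | yes refl = begin
    rowTerm (suc x) l l′ x                                 ≡⟨ rowTerm-pred x ⟩
    dropRow (suc x) l l′                                   ≡⟨ ℚₚ.+-identityˡ _ ⟨
    0ℚ + dropRow (suc x) l l′                              ≡⟨ cong₂ _+_ (pointMass-other _ x≢a) (pointMass-self x _) ⟨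
    pointMass (suc x) (keepRow (suc x) l l′) x + dropMass (suc x) l l′ x ∎
    where open ≡-Reasoning
  ...   | no 1+x≢a = begin
    rowTerm a l l′ x                                       ≡⟨ rowTerm-far x≢a 1+x≢a ⟩
    0ℚ                                                     ≡⟨ cong₂ _+_ (pointMass-other _ x≢a) (dropMass-far 1+x≢a) ⟨
    pointMass a (keepRow a l l′) x + dropMass a l l′ x     ∎
    where open ≡-Reasoning

  partialSum-rowTerm : ∀ a K → (a < K ⊎ keepRow a l l′ ≡ 0ℚ) → (∀ k → a ≡ suc k → k < K ⊎ dropRow a l l′ ≡ 0ℚ) →
    partialSum (rowTerm a l l′) K ≡ rowFactor a l l′
  partialSum-rowTerm a K keep-ok drop-ok = begin
    partialSum (rowTerm a l l′) K
      ≡⟨ partialSum-cong K (λ x _ → rowTerm-split a x) ⟩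
    partialSum (λ x → pointMass a (keepRow a l l′) x + dropMass a l l′ x) K
      ≡⟨ partialSum-+ _ _ K ⟩
    partialSum (pointMass a (keepRow a l l′)) K + partialSum (dropMass a l l′) K
      ≡⟨ cong₂ _+_ (partialSum-pointMass a _ K keep-ok) (partialSum-dropMass a drop-ok) ⟩
    rowFactor a l l′ ∎
    where
    open ≡-Reasoning
    partialSum-dropMass : ∀ a → (∀ k → a ≡ suc k → k < K ⊎ dropRow a l l′ ≡ 0ℚ) →
      partialSum (dropMass a l l′) K ≡ dropRow a l l′
    partialSum-dropMass zero    _       = partialSum-zero K (λ _ _ → refl)
    partialSum-dropMass (suc k) drop-ok = partialSum-pointMass k _ K (drop-ok k refl)

  rowTerm-support : ∀ a x → rowTerm a l l′ x ≡ 0ℚ ⊎ (x ≤ a × l′ ≤ x)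
  rowTerm-support a x with x ≤ᵇ a in x≤ᵇa | l′ ≤ᵇ x in l′≤ᵇx
  ... | false | _     = inj₁ refl
  ... | true  | false = inj₁ (cong (if_then sgn (a ∸ x) else 0ℚ) (Boolₚ.∧-zeroʳ (a ≤ᵇ suc x)))
  ... | true  | true  = inj₂ (≤ᵇ≡true⇒≤ x≤ᵇa , ≤ᵇ≡true⇒≤ l′≤ᵇx)

  rowTerm-*-cong : ∀ a x {v w} → (x ≤ a → l′ ≤ x → v ≡ w) → rowTerm a l l′ x * v ≡ rowTerm a l l′ x * w
  rowTerm-*-cong a x {v} {w} v≡w with rowTerm-support a x
  ... | inj₁ term≡0 =
    trans (cong (_* v) term≡0) (trans (ℚₚ.*-zeroˡ v) (sym (trans (cong (_* w) term≡0) (ℚₚ.*-zeroˡ w))))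
  ... | inj₂ (x≤a , l′≤x) = cong (rowTerm a l l′ x *_) (v≡w x≤a l′≤x)

  keepRow-vanishes : ∀ {a} → ¬ a ≤ l → keepRow a l l′ ≡ 0ℚ
  keepRow-vanishes {a} a≰l =
    cong (if_then 1ℚ else 0ℚ) (trans (cong ((l′ ≤ᵇ a) ∧_) (≰⇒≤ᵇ≡false a≰l)) (Boolₚ.∧-zeroʳ _))

  dropRow-vanishes : ∀ {k} → ¬ k ≤ l → dropRow (suc k) l l′ ≡ 0ℚ
  dropRow-vanishes {k} k≰l =
    cong (if_then - 1ℚ else 0ℚ) (trans (cong ((l′ ≤ᵇ k) ∧_) (≰⇒≤ᵇ≡false k≰l)) (Boolₚ.∧-zeroʳ _))

  partialSum-rowTerm-⊓ : ∀ {a b N} → a ≤ N → a ⊓ l ≤ b → partialSum (rowTerm a l l′) (suc (b ⊓ N)) ≡ rowFactor a l l′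
  partialSum-rowTerm-⊓ {a} {b} {N} a≤N a⊓l≤b = partialSum-rowTerm a (suc (b ⊓ N)) keep-ok drop-ok
    where
    keep-ok : a < suc (b ⊓ N) ⊎ keepRow a l l′ ≡ 0ℚ
    keep-ok with a ℕ.≤? b
    ... | yes a≤b = inj₁ (s≤s (ℕₚ.⊓-glb a≤b a≤N))
    ... | no  a≰b = inj₂ (keepRow-vanishes (λ a≤l → a≰b (ℕₚ.≤-trans (ℕₚ.≤-reflexive (sym (ℕₚ.m≤n⇒m⊓n≡m a≤l))) a⊓l≤b)))
    drop-ok : ∀ k → a ≡ suc k → k < suc (b ⊓ N) ⊎ dropRow a l l′ ≡ 0ℚ
    drop-ok k refl with k ℕ.≤? b
    ... | yes k≤b = inj₁ (s≤s (ℕₚ.⊓-glb k≤b (ℕₚ.≤-trans (ℕₚ.n≤1+n k) a≤N)))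
    ... | no  k≰b = inj₂ (dropRow-vanishes (λ k≤l → k≰b (ℕₚ.≤-trans (ℕₚ.⊓-glb (ℕₚ.n≤1+n k) k≤l) a⊓l≤b)))

WeightSum : List ℕ → List ℕ → Set
WeightSum α λ′ = ∀ N b → size α ≤ N → hd α ⊓ hd λ′ ≤ b → sumPartitions N b (weight α λ′) ≡ rowProduct α λ′

-- Split off the first part x of μ: rowTerm vanishes unless λ′₂ ≤ x ≤ α₁, and then the
-- remaining parts of μ range over exactly the partitions covered by the hypothesis.
sumPartitions-weight-step : ∀ α λ′ → WeightSum (tl α) (tl λ′) → WeightSum α λ′
sumPartitions-weight-step α λ′ IH N b α≤N a⊓l≤b = begin
  sumPartitions N b (weight α λ′)
    ≡⟨ sumPartitions-firstRow N b (weight α λ′) ⟩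
  weight α λ′ [] + partialSum (λ i → sumPartitions (N ∸ suc i) (suc i) (weight α λ′ ∘ (suc i ∷_))) (b ⊓ N)
    ≡⟨ cong₂ _+_ (weight-[] α λ′) (partialSum-cong (b ⊓ N) (λ i _ → trans
         (sumPartitions-cong (N ∸ suc i) (suc i) (weight-∷ α λ′ (suc i)))
         (sumPartitions-*ˡ (N ∸ suc i) (suc i) (term (suc i)) (weight α′ λ″)))) ⟩
  term 0 * weight α′ λ″ [] + partialSum (λ i → term (suc i) * sumPartitions (N ∸ suc i) (suc i) (weight α′ λ″)) (b ⊓ N)
    ≡⟨ cong₂ _+_ (rowTerm-*-cong l l′ a 0 (λ _ l′≤0 → trans (sym (sumPartitions-bound0 (size α′) (weight α′ λ″)))
                     (IH (size α′) 0 ℕₚ.≤-refl (tail⊓≤ l′≤0))))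
                 (partialSum-cong (b ⊓ N) (λ i _ → rowTerm-*-cong l l′ a (suc i) (λ 1+i≤a l′≤1+i →
                     IH (N ∸ suc i) (suc i) (tail≤ 1+i≤a) (tail⊓≤ l′≤1+i)))) ⟩
  term 0 * rest + partialSum (λ i → term (suc i) * rest) (b ⊓ N)
    ≡⟨ partialSum-suc (λ x → term x * rest) (b ⊓ N) ⟨
  partialSum (λ x → term x * rest) (suc (b ⊓ N))
    ≡⟨ partialSum-*ʳ term rest (suc (b ⊓ N)) ⟩
  partialSum term (suc (b ⊓ N)) * rest
    ≡⟨ cong (_* rest) (partialSum-rowTerm-⊓ l l′ a≤N a⊓l≤b) ⟩
  rowFactor a l l′ * rest
    ≡⟨ rowProduct-step α λ′ ⟨
  rowProduct α λ′ ∎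
  where
  open ≡-Reasoning
  a = hd α
  α′ = tl α
  l = hd λ′
  λ″ = tl λ′
  l′ = hd λ″
  rest = rowProduct α′ λ″
  term = rowTerm a l l′
  a≤N : a ≤ N
  a≤N = ℕₚ.≤-trans (ℕₚ.≤-trans (ℕₚ.m≤m+n a (size α′)) (ℕₚ.≤-reflexive (sym (size-hd-tl α)))) α≤N
  tail≤ : ∀ {x} → x ≤ a → size α′ ≤ N ∸ x
  tail≤ {x} x≤a = ℕₚ.≤-trans (ℕₚ.≤-reflexive (sym (ℕₚ.m+n∸m≡n a (size α′))))
    (ℕₚ.≤-trans (ℕₚ.∸-monoˡ-≤ a (ℕₚ.≤-trans (ℕₚ.≤-reflexive (sym (size-hd-tl α))) α≤N)) (ℕₚ.∸-monoʳ-≤ N x≤a))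
  tail⊓≤ : ∀ {x} → l′ ≤ x → hd α′ ⊓ l′ ≤ x
  tail⊓≤ l′≤x = ℕₚ.≤-trans (ℕₚ.m⊓n≤n (hd α′) l′) l′≤x

sumPartitions-weight : ∀ α λ′ → WeightSum α λ′
sumPartitions-weight [] [] N b _ _ = begin
  sumPartitions N b (weight [] [])
    ≡⟨ sumPartitions-firstRow N b (weight [] []) ⟩
  1ℚ + partialSum (λ i → sumPartitions (N ∸ suc i) (suc i) (weight [] [] ∘ (suc i ∷_))) (b ⊓ N)
    ≡⟨ cong (1ℚ +_) (partialSum-zero (b ⊓ N) (λ i _ → partialSum-zero (suc (N ∸ suc i)) (λ n _ →
         sumMap-zero (partsF n n (suc i))))) ⟩
  1ℚ + 0ℚ ∎
  where open ≡-Reasoning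
sumPartitions-weight []      (l ∷ λ′) = sumPartitions-weight-step [] (l ∷ λ′) (sumPartitions-weight [] λ′)
sumPartitions-weight (a ∷ α) []       = sumPartitions-weight-step (a ∷ α) [] (sumPartitions-weight α [])
sumPartitions-weight (a ∷ α) (l ∷ λ′) = sumPartitions-weight-step (a ∷ α) (l ∷ λ′) (sumPartitions-weight α λ′)

-- The partitions α⁽ᵐ⁾

-- The number j of leading parts of α that are ≥ m, i.e. the j with αⱼ ≥ m > αⱼ₊₁.
partsAtLeast : ℕ → List ℕ → ℕ
partsAtLeast m []       = 0
partsAtLeast m (x ∷ xs) = if m ≤ᵇ x then suc (partsAtLeast m xs) else 0

module _ {m x : ℕ} (xs : List ℕ) where

  shift-≤ : m ≤ x → shift m (x ∷ xs) ≡ consPos (x ∸ 1) (shift m xs)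
  shift-≤ m≤x rewrite ≤⇒≤ᵇ≡true m≤x = refl

  shift-≰ : ¬ m ≤ x → shift m (x ∷ xs) ≡ consPos (m ∸ 1) (x ∷ xs)
  shift-≰ m≰x rewrite ≰⇒≤ᵇ≡false m≰x = refl

  partsAtLeast-≤ : m ≤ x → partsAtLeast m (x ∷ xs) ≡ suc (partsAtLeast m xs)
  partsAtLeast-≤ m≤x rewrite ≤⇒≤ᵇ≡true m≤x = refl

  partsAtLeast-≰ : ¬ m ≤ x → partsAtLeast m (x ∷ xs) ≡ 0
  partsAtLeast-≰ m≰x rewrite ≰⇒≤ᵇ≡false m≰x = refl

shift-< : ∀ m xs → hd xs < m → shift m xs ≡ consPos (m ∸ 1) xs
shift-< m []       _    = refl
shift-< m (x ∷ xs) x<m = shift-≰ xs (ℕₚ.<⇒≱ x<m)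

hd-consPos : ∀ y L → hd L ≤ y → hd (consPos y L) ≤ y
hd-consPos zero    L L≤0 = L≤0
hd-consPos (suc y) L _   = ℕₚ.≤-refl

size-consPos : ∀ y L → size (consPos y L) ≡ y ℕ.+ size L
size-consPos zero    L = refl
size-consPos (suc y) L = refl

consPos-IsPartition : ∀ y L → IsPartition L → hd L ≤ y → IsPartition (consPos y L)
consPos-IsPartition zero    L       ptn _   = ptn
consPos-IsPartition (suc y) []      _   _   = one (s≤s z≤n)
consPos-IsPartition (suc y) (z ∷ L) ptn z≤y = cons z≤y ptn

hd-shift≤ : ∀ n {x} xs → IsPartition (x ∷ xs) → suc n ≤ x → hd (shift (suc n) xs) ≤ x ∸ 1
hd-shift≤ n []       _   m≤x = ℕₚ.≤-trans (hd-consPos n [] z≤n) (ℕₚ.∸-monoˡ-≤ 1 m≤x)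
hd-shift≤ n (y ∷ ys) ptn m≤x with suc n ℕ.≤? y
... | yes m≤y rewrite shift-≤ ys m≤y =
  ℕₚ.≤-trans (hd-consPos (y ∸ 1) _ (hd-shift≤ n ys (IsPartition-tl ptn) m≤y)) (ℕₚ.∸-monoˡ-≤ 1 (hd≤head ptn))
... | no  m≰y rewrite shift-≰ ys m≰y =
  ℕₚ.≤-trans (hd-consPos n (y ∷ ys) (ℕₚ.≤-pred (ℕₚ.≰⇒> m≰y))) (ℕₚ.∸-monoˡ-≤ 1 m≤x)

shift-IsPartition : ∀ n {α} → IsPartition α → IsPartition (shift (suc n) α)
shift-IsPartition n {[]}     _   = consPos-IsPartition n [] nil z≤n
shift-IsPartition n {x ∷ xs} ptn with suc n ℕ.≤? x
... | yes m≤x rewrite shift-≤ xs m≤x =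
  consPos-IsPartition (x ∸ 1) _ (shift-IsPartition n (IsPartition-tl ptn)) (hd-shift≤ n xs ptn m≤x)
... | no  m≰x rewrite shift-≰ xs m≰x = consPos-IsPartition n (x ∷ xs) ptn (ℕₚ.≤-pred (ℕₚ.≰⇒> m≰x))

size-shift : ∀ n α → size α ℕ.+ suc n ≡ suc (size (shift (suc n) α)) ℕ.+ partsAtLeast (suc n) α
size-shift n [] = cong suc (sym (trans (ℕₚ.+-identityʳ _) (trans (size-consPos n []) (ℕₚ.+-identityʳ n))))
size-shift n (x ∷ xs) with suc n ℕ.≤? x
... | yes m≤x rewrite shift-≤ xs m≤x | partsAtLeast-≤ xs m≤x = begin
  (x ℕ.+ size xs) ℕ.+ suc n      ≡⟨ ℕₚ.+-assoc x (size xs) (suc n) ⟩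
  x ℕ.+ (size xs ℕ.+ suc n)      ≡⟨ cong (x ℕ.+_) (size-shift n xs) ⟩
  x ℕ.+ (suc S ℕ.+ j)            ≡⟨ cong (ℕ._+ (suc S ℕ.+ j)) (ℕₚ.m+[n∸m]≡n (ℕₚ.≤-trans (s≤s z≤n) m≤x)) ⟨
  suc (x ∸ 1) ℕ.+ (suc S ℕ.+ j)  ≡⟨ rearrange (x ∸ 1) S j ⟩
  suc ((x ∸ 1) ℕ.+ S) ℕ.+ suc j  ≡⟨ cong (λ z → suc z ℕ.+ suc j) (size-consPos (x ∸ 1) (shift (suc n) xs)) ⟨
  suc (size (consPos (x ∸ 1) (shift (suc n) xs))) ℕ.+ suc j ∎
  where
  open ≡-Reasoning
  S = size (shift (suc n) xs)
  j = partsAtLeast (suc n) xs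
  rearrange : ∀ a b c → suc a ℕ.+ (suc b ℕ.+ c) ≡ suc (a ℕ.+ b) ℕ.+ suc c
  rearrange = solve-∀
... | no m≰x rewrite shift-≰ xs m≰x | partsAtLeast-≰ xs m≰x | size-consPos n (x ∷ xs) =
  rearrange (x ℕ.+ size xs) n
  where
  rearrange : ∀ a n → a ℕ.+ suc n ≡ suc (n ℕ.+ a) ℕ.+ 0
  rearrange = solve-∀

partsAtLeast≤size : ∀ n α → partsAtLeast (suc n) α ≤ size α
partsAtLeast≤size n []       = z≤n
partsAtLeast≤size n (x ∷ xs) with suc n ℕ.≤? x
... | yes m≤x rewrite partsAtLeast-≤ xs m≤x = ℕₚ.+-mono-≤ (ℕₚ.≤-trans (s≤s z≤n) m≤x) (partsAtLeast≤size n xs)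
... | no  m≰x rewrite partsAtLeast-≰ xs m≰x = z≤n

partsAtLeast-antitone : ∀ {n n′} α → n ≤ n′ → partsAtLeast (suc n′) α ≤ partsAtLeast (suc n) α
partsAtLeast-antitone []       _    = z≤n
partsAtLeast-antitone {n} {n′} (x ∷ xs) n≤n′ with suc n′ ℕ.≤? x
... | yes m′≤x rewrite partsAtLeast-≤ xs m′≤x | partsAtLeast-≤ xs (ℕₚ.≤-trans (s≤s n≤n′) m′≤x) =
  s≤s (partsAtLeast-antitone xs n≤n′)
... | no  m′≰x rewrite partsAtLeast-≰ xs m′≰x = z≤n

n≤size-shift : ∀ n α → n ≤ size (shift (suc n) α)
n≤size-shift n α = ℕₚ.≤-pred (ℕₚ.+-cancelˡ-≤ (size α) (suc n) (suc S) (begin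
  size α ℕ.+ suc n                              ≡⟨ size-shift n α ⟩
  suc S ℕ.+ partsAtLeast (suc n) α              ≤⟨ ℕₚ.+-monoʳ-≤ (suc S) (partsAtLeast≤size n α) ⟩
  suc S ℕ.+ size α                              ≡⟨ ℕₚ.+-comm (suc S) (size α) ⟩
  size α ℕ.+ suc S                              ∎))
  where
  open ℕₚ.≤-Reasoning
  S = size (shift (suc n) α)

size-shift-strictMono : ∀ {n n′} α → n < n′ → size (shift (suc n) α) < size (shift (suc n′) α)
size-shift-strictMono {n} {n′} α n<n′ = ℕₚ.≤-pred (ℕₚ.+-cancelʳ-≤ j (suc (suc S)) (suc S′) (begin
  suc (suc S) ℕ.+ j                   ≡⟨ cong suc (size-shift n α) ⟨
  suc (size α ℕ.+ suc n)              ≡⟨ ℕₚ.+-suc (size α) (suc n) ⟨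
  size α ℕ.+ suc (suc n)              ≤⟨ ℕₚ.+-monoʳ-≤ (size α) (s≤s n<n′) ⟩
  size α ℕ.+ suc n′                   ≡⟨ size-shift n′ α ⟩
  suc S′ ℕ.+ partsAtLeast (suc n′) α  ≤⟨ ℕₚ.+-monoʳ-≤ (suc S′) (partsAtLeast-antitone α (ℕₚ.<⇒≤ n<n′)) ⟩
  suc S′ ℕ.+ j                        ∎))
  where
  open ℕₚ.≤-Reasoning
  S  = size (shift (suc n) α)
  S′ = size (shift (suc n′) α)
  j  = partsAtLeast (suc n) α

size-shift-injective : ∀ {n n′} α → size (shift (suc n) α) ≡ size (shift (suc n′) α) → n ≡ n′
size-shift-injective {n} {n′} α eq with ℕₚ.<-cmp n n′
... | tri< n<n′ _ _ = ⊥-elim (ℕₚ.<-irrefl eq (size-shift-strictMono α n<n′))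
... | tri≈ _ n≡n′ _ = n≡n′
... | tri> _ _ n′<n = ⊥-elim (ℕₚ.<-irrefl (sym eq) (size-shift-strictMono α n′<n))

rowFactor-full : ∀ x l → x ≤ l → rowFactor x l x ≡ 1ℚ
rowFactor-full x l x≤l rewrite ≤⇒≤ᵇ≡true (ℕₚ.≤-refl {x}) | ≤⇒≤ᵇ≡true x≤l =
  trans (cong (1ℚ +_) (noDrop x)) (ℚₚ.+-identityʳ 1ℚ)
  where
  noDrop : ∀ x → dropRow x l x ≡ 0ℚ
  noDrop zero    = refl
  noDrop (suc k) rewrite ≰⇒≤ᵇ≡false (ℕₚ.<-irrefl (refl {x = k})) = refl

rowFactor-dropped : ∀ k l′ → l′ ≤ k → rowFactor (suc k) k l′ ≡ - 1ℚ
rowFactor-dropped k l′ l′≤k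
  rewrite ≰⇒≤ᵇ≡false (ℕₚ.<-irrefl (refl {x = k})) | ≤⇒≤ᵇ≡true l′≤k | ≤⇒≤ᵇ≡true (ℕₚ.≤-refl {k}) =
  trans (cong (λ b → (if b then 1ℚ else 0ℚ) + - 1ℚ) (Boolₚ.∧-zeroʳ (l′ ≤ᵇ suc k))) (ℚₚ.+-identityˡ _)

rowProduct-cons-self : ∀ α y → IsPartition α → hd α ≤ y → rowProduct α (y ∷ α) ≡ 1ℚ
rowProduct-cons-self []       y _   _   = trans (ℚₚ.*-identityʳ _) (rowFactor-full 0 y z≤n)
rowProduct-cons-self (x ∷ xs) y ptn x≤y =
  trans (cong₂ _*_ (rowFactor-full x y x≤y) (rowProduct-cons-self xs x (IsPartition-tl ptn) (hd≤head ptn)))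
        (ℚₚ.*-identityˡ 1ℚ)

rowProduct-drop : ∀ k xs L → Positive L → hd L ≤ k → rowProduct (suc k ∷ xs) (consPos k L) ≡ - rowProduct xs L
rowProduct-drop zero    xs []      _           _   =
  trans (cong (_* rowProduct xs []) (rowFactor-dropped 0 0 z≤n)) (-1*x≈-x _)
rowProduct-drop zero    xs (y ∷ L) (1≤y ∷ _) y≤0 = ⊥-elim (ℕₚ.<-irrefl refl (ℕₚ.≤-trans 1≤y y≤0))
rowProduct-drop (suc k) xs L       _           L≤k =
  trans (cong (_* rowProduct xs L) (rowFactor-dropped (suc k) (hd L) L≤k)) (-1*x≈-x _)

rowProduct-shift : ∀ n α → IsPartition α → rowProduct α (shift (suc n) α) ≡ sgn (partsAtLeast (suc n) α)
rowProduct-shift zero    []       _   = refl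
rowProduct-shift (suc n) []       _   = rowProduct-cons-self [] (suc n) nil z≤n
rowProduct-shift n       (zero ∷ xs) ptn = ⊥-elim (ℕₚ.<-irrefl refl (1≤head ptn))
rowProduct-shift n       (suc k ∷ xs) ptn with suc n ℕ.≤? suc k
... | yes m≤x rewrite shift-≤ xs m≤x | partsAtLeast-≤ xs m≤x = begin
  rowProduct (suc k ∷ xs) (consPos k (shift (suc n) xs))
    ≡⟨ rowProduct-drop k xs (shift (suc n) xs) (IsPartition⇒Positive (shift-IsPartition n (IsPartition-tl ptn)))
         (hd-shift≤ n xs ptn m≤x) ⟩
  - rowProduct xs (shift (suc n) xs)               ≡⟨ cong -_ (rowProduct-shift n xs (IsPartition-tl ptn)) ⟩
  - sgn (partsAtLeast (suc n) xs)                  ≡⟨ sgn-suc (partsAtLeast (suc n) xs) ⟨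
  sgn (suc (partsAtLeast (suc n) xs))              ∎
  where open ≡-Reasoning
... | no m≰x rewrite shift-≰ xs m≰x | partsAtLeast-≰ xs m≰x with n | ℕₚ.≤-pred (ℕₚ.≰⇒> m≰x)
...   | suc n′ | x≤n = rowProduct-cons-self (suc k ∷ xs) (suc n′) ptn x≤n

rowFactor≢0 : ∀ a l l′ → rowFactor a l l′ ≢ 0ℚ → (l′ ≡ a × a ≤ l) ⊎ (suc l ≡ a × l′ ≤ l)
rowFactor≢0 zero l l′ ≢0 with l′ ≤ᵇ 0 in l′≤ᵇ0
... | true  = inj₁ (ℕₚ.n≤0⇒n≡0 (≤ᵇ≡true⇒≤ l′≤ᵇ0) , z≤n)
... | false = ⊥-elim (≢0 refl)
rowFactor≢0 (suc k) l l′ ≢0 with l′ ≤ᵇ suc k in l′≤a | suc k ≤ᵇ l in a≤l | l′ ≤ᵇ k in l′≤k | k ≤ᵇ l in k≤l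
... | true  | true  | false | _     =
  inj₁ (ℕₚ.≤-antisym (≤ᵇ≡true⇒≤ l′≤a) (ℕₚ.≰⇒> (≤ᵇ≡false⇒≰ l′≤k)) , ≤ᵇ≡true⇒≤ a≤l)
... | _     | false | true  | true  =
  inj₂ (cong suc (ℕₚ.≤-antisym (ℕₚ.≤-pred (ℕₚ.≰⇒> (≤ᵇ≡false⇒≰ a≤l))) (≤ᵇ≡true⇒≤ k≤l)) ,
        ℕₚ.≤-trans (≤ᵇ≡true⇒≤ l′≤k) (≤ᵇ≡true⇒≤ k≤l))
... | true  | true  | true  | true  = ⊥-elim (≢0 refl)
... | true  | true  | true  | false = ⊥-elim (≤ᵇ≡false⇒≰ {k} {l} k≤l (ℕₚ.<⇒≤ (≤ᵇ≡true⇒≤ a≤l)))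
... | false | _     | true  | true  = ⊥-elim (≤ᵇ≡false⇒≰ {l′} {suc k} l′≤a (ℕₚ.m≤n⇒m≤1+n (≤ᵇ≡true⇒≤ {l′} {k} l′≤k)))
... | false | _     | false | _     = ⊥-elim (≢0 refl)
... | false | _     | true  | false = ⊥-elim (≢0 refl)
... | true  | false | false | _     = ⊥-elim (≢0 refl)
... | true  | false | true  | false = ⊥-elim (≢0 refl)

*≢0⇒ˡ≢0 : ∀ p q → p * q ≢ 0ℚ → p ≢ 0ℚ
*≢0⇒ˡ≢0 p q pq≢0 p≡0 = pq≢0 (trans (cong (_* q) p≡0) (ℚₚ.*-zeroˡ q))

*≢0⇒ʳ≢0 : ∀ p q → p * q ≢ 0ℚ → q ≢ 0ℚ
*≢0⇒ʳ≢0 p q pq≢0 q≡0 = pq≢0 (trans (cong (p *_) q≡0) (ℚₚ.*-zeroʳ p))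

consPos-hd-tl : ∀ {λ′} → Positive λ′ → consPos (hd λ′) (tl λ′) ≡ λ′
consPos-hd-tl {[]}          _ = refl
consPos-hd-tl {zero ∷ λ′}  (() ∷ _)
consPos-hd-tl {suc y ∷ λ′} _ = refl

Positive-tl : ∀ {λ′} → Positive λ′ → Positive (tl λ′)
Positive-tl []        = []
Positive-tl (_ ∷ pos) = pos

Positive-hd≤0 : ∀ {L} → Positive L → hd L ≤ 0 → L ≡ []
Positive-hd≤0 []          _   = refl
Positive-hd≤0 (1≤y ∷ _) y≤0 = ⊥-elim (ℕₚ.<-irrefl refl (ℕₚ.≤-trans 1≤y y≤0))

module _ {x : ℕ} {xs : List ℕ} (ptn : IsPartition (x ∷ xs)) where

  shift-hd≡head : ∀ n → hd (shift (suc n) xs) ≡ x → shift (suc n) xs ≡ x ∷ xs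
  shift-hd≡head n hd≡x with suc n ℕ.≤? hd xs
  ... | yes m≤y = ⊥-elim (ℕₚ.<-irrefl hd≡x
                    (ℕₚ.≤-trans (s≤s (hd-shift≤ n xs ptn (ℕₚ.≤-trans m≤y (hd≤head ptn)))) (ℕₚ.≤-reflexive 1+[x∸1]≡x)))
    where 1+[x∸1]≡x = ℕₚ.m+[n∸m]≡n (1≤head ptn)
  ... | no  m≰y rewrite shift-< (suc n) xs (ℕₚ.≰⇒> m≰y) with n
  ...   | zero   = ⊥-elim (m≰y (subst (1 ≤_) (sym hd≡x) (1≤head ptn)))
  ...   | suc n′ = cong (_∷ xs) hd≡x

  shift-hd<head⇒≤ : ∀ n → hd (shift (suc n) xs) < x → suc n ≤ x
  shift-hd<head⇒≤ n hd<x with suc n ℕ.≤? x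
  ... | yes m≤x = m≤x
  ... | no  m≰x rewrite shift-< (suc n) xs (ℕₚ.<-≤-trans (s≤s (hd≤head ptn)) (ℕₚ.≰⇒> m≰x)) with n | ℕₚ.≤-pred (ℕₚ.≰⇒> m≰x)
  ...   | zero   | x≤0 = ⊥-elim (ℕₚ.<-irrefl refl (ℕₚ.≤-trans (1≤head ptn) x≤0))
  ...   | suc n′ | x≤n = ⊥-elim (ℕₚ.<⇒≱ hd<x x≤n)

rowProduct≢0⇒shift : ∀ α λ′ → IsPartition α → Positive λ′ → rowProduct α λ′ ≢ 0ℚ → Σ ℕ (λ n → λ′ ≡ shift (suc n) α)
rowProduct≢0⇒shift []       []       _   _   _  = 0 , refl
rowProduct≢0⇒shift []       (l ∷ λ″) _   pos ≢0 with rowFactor≢0 0 l (hd λ″) (*≢0⇒ˡ≢0 _ _ ≢0)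
... | inj₁ (l′≡0 , _) = l , trans (cong (l ∷_) (Positive-hd≤0 (Positive-tl pos) (ℕₚ.≤-reflexive l′≡0)))
                                  (sym (consPos-hd-tl (All.head pos ∷ [])))
... | inj₂ (() , _)
rowProduct≢0⇒shift (x ∷ xs) λ′ ptn pos ≢0
  with rowProduct≢0⇒shift xs (tl λ′) (IsPartition-tl ptn) (Positive-tl pos)
         (*≢0⇒ʳ≢0 (rowFactor x (hd λ′) (hd (tl λ′))) _ ≢0′)
     | rowFactor≢0 x (hd λ′) (hd (tl λ′)) (*≢0⇒ˡ≢0 _ _ ≢0′)
  where
  ≢0′ : rowFactor x (hd λ′) (hd (tl λ′)) * rowProduct xs (tl λ′) ≢ 0ℚ
  ≢0′ = ≢0 ∘ trans (rowProduct-step (x ∷ xs) λ′)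
... | n , tl≡ | inj₁ (l′≡x , x≤l) = hd λ′ , (begin
  λ′                          ≡⟨ consPos-hd-tl pos ⟨
  consPos (hd λ′) (tl λ′)     ≡⟨ cong (consPos (hd λ′)) (trans tl≡ (shift-hd≡head ptn n (trans (cong hd (sym tl≡)) l′≡x))) ⟩
  consPos (hd λ′) (x ∷ xs)    ≡⟨ shift-< (suc (hd λ′)) (x ∷ xs) (s≤s x≤l) ⟨
  shift (suc (hd λ′)) (x ∷ xs) ∎)
  where open ≡-Reasoning
... | n , tl≡ | inj₂ (1+l≡x , l′≤l) = n , (begin
  λ′                                   ≡⟨ consPos-hd-tl pos ⟨
  consPos (hd λ′) (tl λ′)              ≡⟨ cong₂ consPos (cong (_∸ 1) 1+l≡x) tl≡ ⟩
  consPos (x ∸ 1) (shift (suc n) xs)   ≡⟨ shift-≤ xs (shift-hd<head⇒≤ ptn n hd<x) ⟨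
  shift (suc n) (x ∷ xs)               ∎)
  where
  open ≡-Reasoning
  hd<x : hd (shift (suc n) xs) < x
  hd<x = ℕₚ.≤-trans (s≤s (ℕₚ.≤-trans (ℕₚ.≤-reflexive (cong hd (sym tl≡))) l′≤l)) (ℕₚ.≤-reflexive 1+l≡x)

+m-+n≡+o : ∀ {m n o} → m ≡ n ℕ.+ o → ℤ.+ m ℤ.- ℤ.+ n ≡ ℤ.+ o
+m-+n≡+o {n = n} {o} refl = trans (cong (ℤ._- ℤ.+ n) (ℤₚ.pos-+ n o)) (cancel (ℤ.+ n) (ℤ.+ o))
  where
  cancel : ∀ x y → (x ℤ.+ y) ℤ.- x ≡ y
  cancel = ℤ-Solver.solve-∀

+m-+n≡+m-+o⇒n≡o : ∀ m {n o} → ℤ.+ m ℤ.- ℤ.+ n ≡ ℤ.+ m ℤ.- ℤ.+ o → n ≡ o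
+m-+n≡+m-+o⇒n≡o m {n} {o} eq =
  ℤₚ.+-injective (trans (sym (recover (ℤ.+ m) (ℤ.+ n))) (trans (cong (λ z → ℤ.+ m ℤ.- z) eq) (recover (ℤ.+ m) (ℤ.+ o))))
  where
  recover : ∀ x y → x ℤ.- (x ℤ.- y) ≡ y
  recover = ℤ-Solver.solve-∀

difference-or-above : ∀ A d → Σ ℕ (λ D → d ≡ ℤ.+ A ℤ.- ℤ.+ D) ⊎ ℤ.+ A ℤ.< d
difference-or-above A (ℤ.+ k) with k ℕ.≤? A
... | yes k≤A = inj₁ (A ∸ k , sym (+m-+n≡+o (sym (ℕₚ.m∸n+n≡m k≤A))))
... | no  k≰A = inj₂ (ℤ.+<+ (ℕₚ.≰⇒> k≰A))
difference-or-above A ℤ.-[1+ k ] =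
  inj₁ (A ℕ.+ suc k , sym (trans (cong (λ z → ℤ.+ A ℤ.- z) (ℤₚ.pos-+ A (suc k))) (drop (ℤ.+ A) (ℤ.+ suc k))))
  where
  drop : ∀ x y → x ℤ.- (x ℤ.+ y) ≡ ℤ.- y
  drop = ℤ-Solver.solve-∀

[A-D]≤ᵇm≡A≤ᵇm+D : ∀ A D m → ((ℤ.+ A ℤ.- ℤ.+ D) ℤ.≤ᵇ ℤ.+ m) ≡ (A ≤ᵇ m ℕ.+ D)
[A-D]≤ᵇm≡A≤ᵇm+D A D m = ≡true-ext
  (λ ok → ≤⇒≤ᵇ≡true (ℤₚ.drop‿+≤+ (subst₂ ℤ._≤_ (restore (ℤ.+ A) (ℤ.+ D)) (sym (ℤₚ.pos-+ m D))
                                    (ℤₚ.+-monoˡ-≤ (ℤ.+ D) (ℤₚ.≤ᵇ⇒≤ {ℤ.+ A ℤ.- ℤ.+ D} {ℤ.+ m} (≡true⇒T ok))))))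
  (λ ok → T⇒≡true (ℤₚ.≤⇒≤ᵇ (subst ((ℤ.+ A ℤ.- ℤ.+ D) ℤ.≤_) (+m-+n≡+o (ℕₚ.+-comm m D))
                                    (ℤₚ.+-monoˡ-≤ (ℤ.- ℤ.+ D) (ℤ.+≤+ (≤ᵇ≡true⇒≤ ok))))))
  where
  restore : ∀ x y → (x ℤ.- y) ℤ.+ y ≡ x
  restore = ℤ-Solver.solve-∀

∣m-[A-D]∣≡m+D∸A : ∀ A D m → A ≤ m ℕ.+ D → ℤ.∣ ℤ.+ m ℤ.- (ℤ.+ A ℤ.- ℤ.+ D) ∣ ≡ m ℕ.+ D ∸ A
∣m-[A-D]∣≡m+D∸A A D m A≤m+D = cong ℤ.∣_∣ (begin
  ℤ.+ m ℤ.- (ℤ.+ A ℤ.- ℤ.+ D)    ≡⟨ regroup (ℤ.+ m) (ℤ.+ A) (ℤ.+ D) ⟩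
  (ℤ.+ m ℤ.+ ℤ.+ D) ℤ.- ℤ.+ A    ≡⟨ cong (ℤ._- ℤ.+ A) (ℤₚ.pos-+ m D) ⟨
  ℤ.+ (m ℕ.+ D) ℤ.- ℤ.+ A        ≡⟨ +m-+n≡+o (sym (ℕₚ.m+[n∸m]≡n A≤m+D)) ⟩
  ℤ.+ (m ℕ.+ D ∸ A)              ∎)
  where
  open ≡-Reasoning
  regroup : ∀ x y z → x ℤ.- (y ℤ.- z) ≡ (x ℤ.+ z) ℤ.- y
  regroup = ℤ-Solver.solve-∀

[A-B]+m-1≡j : ∀ A B m j → A ℕ.+ m ≡ suc B ℕ.+ j → (ℤ.+ A ℤ.- ℤ.+ B) ℤ.+ ℤ.+ m ℤ.- ℤ.+ 1 ≡ ℤ.+ j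
[A-B]+m-1≡j A B m j eq = begin
  (ℤ.+ A ℤ.- ℤ.+ B) ℤ.+ ℤ.+ m ℤ.- ℤ.+ 1     ≡⟨ regroup (ℤ.+ A) (ℤ.+ B) (ℤ.+ m) ⟩
  (ℤ.+ A ℤ.+ ℤ.+ m) ℤ.- (ℤ.+ 1 ℤ.+ ℤ.+ B)   ≡⟨ cong₂ ℤ._-_ (ℤₚ.pos-+ A m) (ℤₚ.pos-+ 1 B) ⟨
  ℤ.+ (A ℕ.+ m) ℤ.- ℤ.+ (suc B)             ≡⟨ +m-+n≡+o eq ⟩
  ℤ.+ j                                     ∎
  where
  open ≡-Reasoning
  regroup : ∀ x y z → (x ℤ.- y) ℤ.+ z ℤ.- ℤ.+ 1 ≡ (x ℤ.+ z) ℤ.- (ℤ.+ 1 ℤ.+ y)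
  regroup = ℤ-Solver.solve-∀

[A-B]≤A : ∀ A B → ℤ.+ A ℤ.- ℤ.+ B ℤ.≤ ℤ.+ A
[A-B]≤A A B = subst (ℤ._≤ ℤ.+ A) (sym (ℤₚ.m-n≡m⊖n A B)) (ℤₚ.m⊖n≤m A B)

-- The coefficient of t^d s_α, for d = |α| - D

module Coefficient (a : SymFun) (α : List ℕ) (ptn : IsPartition α) (D : ℕ) where

  A : ℕ
  A = size α

  d : ℤ
  d = ℤ.+ A ℤ.- ℤ.+ D

  rowExpansion : ℚ
  rowExpansion = sumMap (λ λ′ → a λ′ * rowProduct α λ′) (partitionsOf D)

  stripSum : ℕ → ℚ
  stripSum m = sumMap (λ μ → sumMap (λ λ′ → a λ′ * weight α λ′ μ) (partitionsOf D)) (partitionsOf (A ∸ m))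

  hstripSum≡weightSum : ∀ m μ → m ≤ A → A ≤ m ℕ.+ D → size μ ≡ A ∸ m →
    sgn m * (if vstrip μ α then hPerp (ℤ.∣ ℤ.+ m ℤ.- d ∣) a μ else 0ℚ)
      ≡ sumMap (λ λ′ → a λ′ * weight α λ′ μ) (partitionsOf D)
  hstripSum≡weightSum m μ m≤A A≤m+D size≡ rewrite vstrip≡rowwise μ α with rowwise vRow μ α
  ... | false = trans (ℚₚ.*-zeroʳ (sgn m))
    (sym (trans (sumMap-cong (partitionsOf D) (λ λ′ → ℚₚ.*-zeroʳ (a λ′))) (sumMap-zero (partitionsOf D))))
  ... | true  = begin
    sgn m * sumMap (λ λ′ → if hstrip μ λ′ then a λ′ else 0ℚ) (partitionsOf (size μ ℕ.+ ℤ.∣ ℤ.+ m ℤ.- d ∣))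
      ≡⟨ cong (λ n → sgn m * sumMap (λ λ′ → if hstrip μ λ′ then a λ′ else 0ℚ) (partitionsOf n)) |μ|+k≡D ⟩
    sgn m * sumMap (λ λ′ → if hstrip μ λ′ then a λ′ else 0ℚ) (partitionsOf D)
      ≡⟨ sumMap-*ˡ (sgn m) _ (partitionsOf D) ⟨
    sumMap (λ λ′ → sgn m * (if hstrip μ λ′ then a λ′ else 0ℚ)) (partitionsOf D)
      ≡⟨ sumMap-cong (partitionsOf D) signed ⟩
    sumMap (λ λ′ → a λ′ * (if rowwise hRow μ λ′ then sgn (A ∸ size μ) else 0ℚ)) (partitionsOf D) ∎
    where
    open ≡-Reasoning
    |μ|+k≡D : size μ ℕ.+ ℤ.∣ ℤ.+ m ℤ.- d ∣ ≡ D
    |μ|+k≡D = begin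
      size μ ℕ.+ ℤ.∣ ℤ.+ m ℤ.- d ∣   ≡⟨ cong₂ ℕ._+_ size≡ (∣m-[A-D]∣≡m+D∸A A D m A≤m+D) ⟩
      (A ∸ m) ℕ.+ (m ℕ.+ D ∸ A)      ≡⟨ ℕₚ.+-∸-assoc (A ∸ m) A≤m+D ⟨
      (A ∸ m) ℕ.+ (m ℕ.+ D) ∸ A      ≡⟨ cong (_∸ A) (ℕₚ.+-assoc (A ∸ m) m D) ⟨
      (A ∸ m) ℕ.+ m ℕ.+ D ∸ A        ≡⟨ cong (λ n → n ℕ.+ D ∸ A) (ℕₚ.m∸n+n≡m m≤A) ⟩
      A ℕ.+ D ∸ A                    ≡⟨ ℕₚ.m+n∸m≡n A D ⟩
      D                              ∎
    signed : ∀ λ′ → sgn m * (if hstrip μ λ′ then a λ′ else 0ℚ)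
                  ≡ a λ′ * (if rowwise hRow μ λ′ then sgn (A ∸ size μ) else 0ℚ)
    signed λ′ rewrite hstrip≡rowwise μ λ′ with rowwise hRow μ λ′
    ... | false = trans (ℚₚ.*-zeroʳ (sgn m)) (sym (ℚₚ.*-zeroʳ (a λ′)))
    ... | true  = trans (ℚₚ.*-comm (sgn m) (a λ′))
      (cong (λ n → a λ′ * sgn n) (sym (trans (cong (A ∸_) size≡) (ℕₚ.m∸[m∸n]≡n m≤A))))

  lhsTerm≡stripSum : ∀ m → m ≤ A → lhsTerm a α d m ≡ stripSum m
  lhsTerm≡stripSum m m≤A with A ℕ.≤? m ℕ.+ D
  ... | yes A≤m+D = begin
    lhsTerm a α d m
      ≡⟨ if-true (trans ([A-D]≤ᵇm≡A≤ᵇm+D A D m) (≤⇒≤ᵇ≡true A≤m+D)) ⟩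
    sgn m * eMul m (hPerp k a) α
      ≡⟨ cong (sgn m *_) (if-true (≤⇒≤ᵇ≡true m≤A)) ⟩
    sgn m * sumMap vTerm (partitionsOf (A ∸ m))
      ≡⟨ sumMap-*ˡ (sgn m) vTerm (partitionsOf (A ∸ m)) ⟨
    sumMap (λ μ → sgn m * vTerm μ) (partitionsOf (A ∸ m))
      ≡⟨ sumParts-cong (A ∸ m) (A ∸ m) (A ∸ m) (λ μ _ size≡ → hstripSum≡weightSum m μ m≤A A≤m+D size≡) ⟩
    stripSum m ∎
    where
    open ≡-Reasoning
    k = ℤ.∣ ℤ.+ m ℤ.- d ∣
    vTerm : List ℕ → ℚ
    vTerm μ = if vstrip μ α then hPerp k a μ else 0ℚ
  ... | no A≰m+D = trans (if-false (trans ([A-D]≤ᵇm≡A≤ᵇm+D A D m) (≰⇒≤ᵇ≡false A≰m+D)))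
    (sym (sumParts-zero (A ∸ m) (A ∸ m) (A ∸ m) (λ μ _ |μ|≡ → sumParts-zero D D D (λ λ′ _ |λ′|≡ →
      trans (cong (a λ′ *_) (weight-vanishes α λ′ μ (μ≰λ′ {μ} {λ′} |μ|≡ |λ′|≡))) (ℚₚ.*-zeroʳ (a λ′))))))
    where
    μ≰λ′ : ∀ {μ λ′} → size μ ≡ A ∸ m → size λ′ ≡ D → ¬ size μ ≤ size λ′
    μ≰λ′ {μ} |μ|≡ |λ′|≡ μ≤λ′ = A≰m+D (begin
      A                   ≡⟨ ℕₚ.m+[n∸m]≡n m≤A ⟨
      m ℕ.+ (A ∸ m)       ≡⟨ cong (m ℕ.+_) |μ|≡ ⟨
      m ℕ.+ size μ        ≤⟨ ℕₚ.+-monoʳ-≤ m (ℕₚ.≤-trans μ≤λ′ (ℕₚ.≤-reflexive |λ′|≡)) ⟩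
      m ℕ.+ D             ∎)
      where open ℕₚ.≤-Reasoning

  partialSum-lhsTerm : partialSum (lhsTerm a α d) (suc A) ≡ rowExpansion
  partialSum-lhsTerm = begin
    partialSum (lhsTerm a α d) (suc A)
      ≡⟨ partialSum-cong (suc A) (λ m m≤A → lhsTerm≡stripSum m (ℕₚ.≤-pred m≤A)) ⟩
    partialSum stripSum (suc A)
      ≡⟨ partialSum-cong (suc A) (λ m _ →
           sumMap-comm (λ μ λ′ → a λ′ * weight α λ′ μ) (partitionsOf (A ∸ m)) (partitionsOf D)) ⟩
    partialSum (λ m → sumMap (λ λ′ → weightedSum λ′ (A ∸ m)) (partitionsOf D)) (suc A)
      ≡⟨ partialSum-sumMap (λ m λ′ → weightedSum λ′ (A ∸ m)) (suc A) (partitionsOf D) ⟩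
    sumMap (λ λ′ → partialSum (λ m → weightedSum λ′ (A ∸ m)) (suc A)) (partitionsOf D)
      ≡⟨ sumMap-cong (partitionsOf D) summed ⟩
    rowExpansion ∎
    where
    open ≡-Reasoning
    weightedSum : List ℕ → ℕ → ℚ
    weightedSum λ′ n = sumMap (λ μ → a λ′ * weight α λ′ μ) (partitionsOf n)
    summed : ∀ λ′ → partialSum (λ m → weightedSum λ′ (A ∸ m)) (suc A) ≡ a λ′ * rowProduct α λ′
    summed λ′ = begin
      partialSum (λ m → weightedSum λ′ (A ∸ m)) (suc A)
        ≡⟨ partialSum-reverse (weightedSum λ′) A ⟨
      partialSum (weightedSum λ′) (suc A)
        ≡⟨ partialSum-cong (suc A) (λ n n≤A → trans (sumMap-*ˡ (a λ′) (weight α λ′) (partitionsOf n))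
             (cong (λ ps → a λ′ * sumMap (weight α λ′) ps) (sym (partsF-bound n n A (ℕₚ.≤-pred n≤A))))) ⟩
      partialSum (λ n → a λ′ * sumParts n n A (weight α λ′)) (suc A)
        ≡⟨ partialSum-*ˡ (a λ′) _ (suc A) ⟩
      a λ′ * sumPartitions A A (weight α λ′)
        ≡⟨ cong (a λ′ *_) (sumPartitions-weight α λ′ A A ℕₚ.≤-refl (ℕₚ.≤-trans (ℕₚ.m⊓n≤m (hd α) (hd λ′)) (hd≤size α))) ⟩
      a λ′ * rowProduct α λ′ ∎

  lhsTerm-beyond : ∀ m → A < m → lhsTerm a α d m ≡ 0ℚ
  lhsTerm-beyond m A<m = if-0 (d ℤ.≤ᵇ ℤ.+ m) λ _ →
    (trans (cong (sgn m *_) (if-false (≰⇒≤ᵇ≡false (ℕₚ.<⇒≱ A<m)))) (ℚₚ.*-zeroʳ (sgn m)))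

  lhs-HasSum : HasSum (lhsTerm a α d) rowExpansion
  lhs-HasSum = suc A , λ M A<M →
    trans (partialSum-stable _ A<M (λ m A<m _ → lhsTerm-beyond m A<m)) partialSum-lhsTerm

  rhsTerm-other : ∀ n → size (shift (suc n) α) ≢ D → rhsTerm a α d n ≡ 0ℚ
  rhsTerm-other n |ν|≢D = if-0 _ λ guard → ⊥-elim (|ν|≢D (+m-+n≡+m-+o⇒n≡o A
    (ℤₚ.≤-antisym (ℤₚ.≤ᵇ⇒≤ (≡true⇒T (∧-trueˡ guard)))
                  (ℤₚ.≤ᵇ⇒≤ (≡true⇒T (∧-trueʳ {(ℤ.+ A ℤ.- ℤ.+ size (shift (suc n) α)) ℤ.≤ᵇ d} guard))))))

  rhsTerm-selected : ∀ n → size (shift (suc n) α) ≡ D →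
    rhsTerm a α d n ≡ sgn (partsAtLeast (suc n) α) * a (shift (suc n) α)
  rhsTerm-selected n |ν|≡D = trans (if-true (∧-true (≡⇒≤ᵇ≡true e≡d) (≡⇒≤ᵇ≡true (sym e≡d))))
    (cong (λ z → sgnℤ z * a (shift (suc n) α))
          ([A-B]+m-1≡j A (size (shift (suc n) α)) (suc n) (partsAtLeast (suc n) α) (size-shift n α)))
    where
    e≡d : ℤ.+ A ℤ.- ℤ.+ size (shift (suc n) α) ≡ d
    e≡d = cong (λ B → ℤ.+ A ℤ.- ℤ.+ B) |ν|≡D
    ≡⇒≤ᵇ≡true : ∀ {x y} → x ≡ y → (x ℤ.≤ᵇ y) ≡ true
    ≡⇒≤ᵇ≡true x≡y = T⇒≡true (ℤₚ.≤⇒≤ᵇ (ℤₚ.≤-reflexive x≡y))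

  rhsTerm-beyond : ∀ n → D < n → rhsTerm a α d n ≡ 0ℚ
  rhsTerm-beyond n D<n = rhsTerm-other n (λ |ν|≡D → ℕₚ.<-irrefl (sym |ν|≡D) (ℕₚ.<-≤-trans D<n (n≤size-shift n α)))

  rhs-HasSum : HasSum (rhsTerm a α d) (partialSum (rhsTerm a α d) (suc D))
  rhs-HasSum = suc D , λ M D<M → partialSum-stable _ D<M (λ n D<n _ → rhsTerm-beyond n D<n)

  rowProduct-unshifted : ∀ λ′ → Positive λ′ → (∀ n → λ′ ≢ shift (suc n) α) → a λ′ * rowProduct α λ′ ≡ 0ℚ
  rowProduct-unshifted λ′ pos unshifted with rowProduct α λ′ ℚₚ.≟ 0ℚ
  ... | yes ≡0 = trans (cong (a λ′ *_) ≡0) (ℚₚ.*-zeroʳ (a λ′))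
  ... | no  ≢0 = let n , λ′≡ = rowProduct≢0⇒shift α λ′ ptn pos ≢0 in ⊥-elim (unshifted n λ′≡)

  rowExpansion≡partialSum-rhsTerm : rowExpansion ≡ partialSum (rhsTerm a α d) (suc D)
  rowExpansion≡partialSum-rhsTerm with ℕₚ.anyUpTo? (λ n → size (shift (suc n) α) ℕₚ.≟ D) (suc D)
  ... | yes (n , n≤D , |ν|≡D) = begin
    rowExpansion
      ≡⟨ sumParts-single D D D _ ν ℕₚ.≤-refl (shift-IsPartition n ptn) |ν|≡D (ℕₚ.≤-trans (hd≤size ν) (ℕₚ.≤-reflexive |ν|≡D))
           (λ λ′ pos |λ′|≡D λ′≢ν → rowProduct-unshifted λ′ pos (λ n′ λ′≡ → λ′≢ν (trans λ′≡ (cong (λ k → shift (suc k) α)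
             (size-shift-injective α (trans (cong size (sym λ′≡)) (trans |λ′|≡D (sym |ν|≡D)))))))) ⟩
    a ν * rowProduct α ν                  ≡⟨ cong (a ν *_) (rowProduct-shift n α ptn) ⟩
    a ν * sgn (partsAtLeast (suc n) α)    ≡⟨ ℚₚ.*-comm (a ν) _ ⟩
    sgn (partsAtLeast (suc n) α) * a ν    ≡⟨ rhsTerm-selected n |ν|≡D ⟨
    rhsTerm a α d n                       ≡⟨ partialSum-single _ n≤D (λ n′ _ n′≢n → rhsTerm-other n′
                                               (n′≢n ∘ size-shift-injective α ∘ (λ eq → trans eq (sym |ν|≡D)))) ⟨
    partialSum (rhsTerm a α d) (suc D)    ∎
    where
    open ≡-Reasoning
    ν = shift (suc n) α
  ... | no none = trans
    (sumParts-zero D D D (λ λ′ pos |λ′|≡D → rowProduct-unshifted λ′ pos (λ n λ′≡ →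
      none (n , s≤s (ℕₚ.≤-trans (n≤size-shift n α) (ℕₚ.≤-reflexive (trans (cong size (sym λ′≡)) |λ′|≡D))) ,
            trans (cong size (sym λ′≡)) |λ′|≡D))))
    (sym (partialSum-zero (suc D) (λ n n≤D → rhsTerm-other n (λ |ν|≡D → none (n , n≤D , |ν|≡D)))))

-- The coefficient of t^d s_α vanishes on both sides for d > |α|

module _ (a : SymFun) (α : List ℕ) {d : ℤ} (A<d : ℤ.+ size α ℤ.< d) where

  lhsTerm-above : ∀ m → lhsTerm a α d m ≡ 0ℚ
  lhsTerm-above m = if-0 (d ℤ.≤ᵇ ℤ.+ m) λ d≤m →
    trans (cong (sgn m *_) (if-false (≰⇒≤ᵇ≡false λ m≤A →
      ℤₚ.<⇒≱ A<d (ℤₚ.≤-trans (ℤₚ.≤ᵇ⇒≤ (≡true⇒T d≤m)) (ℤ.+≤+ m≤A)))))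
      (ℚₚ.*-zeroʳ (sgn m))

  rhsTerm-above : ∀ n → rhsTerm a α d n ≡ 0ℚ
  rhsTerm-above n = if-0 _ λ guard → ⊥-elim (ℤₚ.<⇒≱ A<d
    (ℤₚ.≤-trans (ℤₚ.≤ᵇ⇒≤ (≡true⇒T (∧-trueʳ {(ℤ.+ size α ℤ.- ℤ.+ size (shift (suc n) α)) ℤ.≤ᵇ d} guard)))
                ([A-B]≤A (size α) (size (shift (suc n) α)))))

corollary3p6 : (a : List ℕ → ℚ) (α : List ℕ) → IsPartition α → (d : ℤ) →
    Σ ℚ (λ c → HasSum (lhsTerm a α d) c × HasSum (rhsTerm a α d) c)
corollary3p6 a α ptn d with difference-or-above (size α) d
... | inj₁ (D , refl) =
  rowExpansion , lhs-HasSum ,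
  subst (HasSum (rhsTerm a α (ℤ.+ size α ℤ.- ℤ.+ D))) (sym rowExpansion≡partialSum-rhsTerm) rhs-HasSum
  where open Coefficient a α ptn D using (rowExpansion; lhs-HasSum; rhs-HasSum; rowExpansion≡partialSum-rhsTerm)
... | inj₂ A<d =
  0ℚ , (0 , λ M _ → partialSum-zero M (λ m _ → lhsTerm-above a α A<d m))
     , (0 , λ M _ → partialSum-zero M (λ n _ → rhsTerm-above a α A<d n))
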